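{- Let $\mathcal{C}$ be a finite semitopological category and $\mathcal{V}$ the category of finite-dimensional $\mathbb{Q}$-vector spaces. The functor $\nu\colon\mathrm{Simp}(\mathcal{C},\mathcal{V})\to\mathcal{I}$, $\nu(F)=\bigoplus_{X\in\mathrm{Ob}(\mathcal{C})}(k_X)_*F(X)$ (acting on morphisms via the identifications $\mathrm{Hom}((k_X)_*V,(k_Y)_*W)\cong\bigoplus_{\varphi\colon X\to Y}\mathrm{Hom}(V,W)$), is an equivalence of categories, i.e. it is fully faithful and essentially surjective, where $\mathcal{I}$ is the full subcategory of injective objects of $\mathbb{Q}(\mathcal{C})$.
   Context: A category is finite if it has finitely many morphisms, semitopological if the only endomorphism of any object is its identity. $\mathbb{Q}(\mathcal{C})$ is the category of functors $\mathcal{C}^{\rm op}\to\mathcal{V}$. $(k_X)_*V$ is the presheaf $Q\mapsto\bigoplus_{\alpha\in\mathrm{Hom}(X,Q)}V$ with maps induced by composition; a morphism $(k_X)_*V\to(k_Y)_*W$ corresponds to a linear map $((k_X)_*V)(Y)=\bigoplus_{\varphi\in\mathrm{Hom}(X,Y)}V\to W$, i.e. a family indexed by $\varphi\colon X\to Y$ of maps $V\to W$. The simplicial Hom category $\mathrm{Simp}(\mathcal{C},\mathcal{V})$ has as objects arbitrary maps $F\colon\mathrm{Ob}(\mathcal{C})\to\mathrm{Ob}(\mathcal{V})$; a morphism $\alpha\colon F\to G$ assigns to each morphism $\varphi\colon X\to Y$ of $\mathcal{C}$ a linear map $\alpha(\varphi)\colon F(X)\to G(Y)$; composition is $(\beta\alpha)(\varphi)=\sum_{\varphi_2\circ\varphi_1=\varphi}\beta(\varphi_2)\alpha(\varphi_1)$;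 the identity of $F$ is $\mathrm{id}_{F(X)}$ on $\mathrm{id}_X$ and $0$ on nonidentity morphisms. -}

module Defs where

open import Data.Nat using (ℕ; zero; suc; _+_)
open import Data.Fin using (Fin; zero; suc; splitAt; _≟_)
open import Data.Rational using (ℚ; 0ℚ; 1ℚ) renaming (_+_ to _+ℚ_; _*_ to _*ℚ_)
open import Data.Product using (Σ; _×_; _,_; ∃; ∃-syntax)
open import Data.Sum using (_⊎_; inj₁; inj₂)
open import Function using (_∘_)
open import Relation.Binary.PropositionalEquality using (_≡_; refl)
open import Relation.Nullary using (yes; no)

Σℚ : ∀ n → (Fin n → ℚ) → ℚ
Σℚ zero    f = 0ℚ
Σℚ (suc n) f = f zero +ℚ Σℚ n (f ∘ suc)

Σℕ : ∀ n → (Fin n → ℕ) → ℕ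
Σℕ zero    d = 0
Σℕ (suc n) d = d zero + Σℕ n (d ∘ suc)

unΣ : ∀ n (d : Fin n → ℕ) → Fin (Σℕ n d) → Σ (Fin n) (λ x → Fin (d x))
unΣ (suc n) d k with splitAt (d zero) k
... | inj₁ i  = zero , i
... | inj₂ k' with unΣ n (d ∘ suc) k'
...   | x , i = suc x , i

δ : ∀ {n} → Fin n → Fin n → ℚ
δ i j with i ≟ j
... | yes _ = 1ℚ
... | no  _ = 0ℚ

-- The category V of finite-dimensional ℚ-vector spaces, in its standard
-- skeletal presentation: objects are dimensions d (the space ℚ^d),
-- a linear map ℚ^d → ℚ^e is an e×d matrix (rows = codomain coordinates).

Lin : ℕ → ℕ → Set
Lin d e = Fin e → Fin d → ℚ

_≈L_ : ∀ {d e} → Lin d e → Lin d e → Set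
A ≈L B = ∀ k i → A k i ≡ B k i

idL : ∀ d → Lin d d
idL d k i = δ k i

zeroL : ∀ {d e} → Lin d e
zeroL k i = 0ℚ

_∘L_ : ∀ {d e f} → Lin e f → Lin d e → Lin d f
_∘L_ {e = e} B A k i = Σℚ e (λ j → B k j *ℚ A j i)

record FinCat : Set where
  field
    nOb   : ℕ
    nHom  : Fin nOb → Fin nOb → ℕ
    idm   : ∀ X → Fin (nHom X X)
    comp  : ∀ {X Y Z} → Fin (nHom Y Z) → Fin (nHom X Y) → Fin (nHom X Z)
    idˡ   : ∀ {X Y} (f : Fin (nHom X Y)) → comp (idm Y) f ≡ f
    idʳ   : ∀ {X Y} (f : Fin (nHom X Y)) → comp f (idm X) ≡ f
    assoc : ∀ {W X Y Z} (h : Fin (nHom Y Z)) (g : Fin (nHom X Y)) (f : Fin (nHom W X))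
            → comp (comp h g) f ≡ comp h (comp g f)

  Ob : Set
  Ob = Fin nOb

  Hom : Ob → Ob → Set
  Hom X Y = Fin (nHom X Y)

Semitopological : FinCat → Set
Semitopological C = ∀ X (f : Hom X X) → f ≡ idm X
  where open FinCat C

module _ (C : FinCat) where
  open FinCat C

  record RawPresheaf : Set where
    field
      dim : Ob → ℕ
      act : ∀ {X Y} → Hom X Y → Lin (dim Y) (dim X)

  open RawPresheaf public

  record IsPresheaf (P : RawPresheaf) : Set where
    field
      act-id   : ∀ X → act P (idm X) ≈L idL (dim P X)
      act-comp : ∀ {X Y Z} (g : Hom Y Z) (f : Hom X Y)
                 → act P (comp g f) ≈L (act P f ∘L act P g)

  Presheaf : Set
  Presheaf = Σ RawPresheaf IsPresheaf

  Components : RawPresheaf → RawPresheaf → Set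
  Components P R = ∀ X → Lin (dim P X) (dim R X)

  IsNatural : (P R : RawPresheaf) → Components P R → Set
  IsNatural P R η = ∀ {X Y} (f : Hom X Y) → (η X ∘L act P f) ≈L (act R f ∘L η Y)

  NatTrans : RawPresheaf → RawPresheaf → Set
  NatTrans P R = Σ (Components P R) (IsNatural P R)

  _≈C_ : ∀ {P R} → Components P R → Components P R → Set
  η ≈C θ = ∀ X → η X ≈L θ X

  idC : ∀ P → Components P P
  idC P X = idL (dim P X)

  _∘C_ : ∀ {P R S} → Components R S → Components P R → Components P S
  (θ ∘C η) X = θ X ∘L η X

  Mono : (A B : Presheaf) → NatTrans (Σ.proj₁ A) (Σ.proj₁ B) → Set
  Mono (A , _) (B , _) (m , _) =
    ∀ (R : Presheaf) (g h : Components (Σ.proj₁ R) A)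
    → IsNatural (Σ.proj₁ R) A g → IsNatural (Σ.proj₁ R) A h
    → _≈C_ {Σ.proj₁ R} {B} (_∘C_ {Σ.proj₁ R} {A} {B} m g) (_∘C_ {Σ.proj₁ R} {A} {B} m h)
    → _≈C_ {Σ.proj₁ R} {A} g h

  Injective : Presheaf → Set
  Injective (I , _) =
    ∀ (A B : Presheaf) (m : NatTrans (Σ.proj₁ A) (Σ.proj₁ B)) → Mono A B m
    → ∀ (f : Components (Σ.proj₁ A) I) → IsNatural (Σ.proj₁ A) I f
    → Σ (Components (Σ.proj₁ B) I) (λ g → IsNatural (Σ.proj₁ B) I g
        × _≈C_ {Σ.proj₁ A} {I} (_∘C_ {Σ.proj₁ A} {Σ.proj₁ B} {I} g (Σ.proj₁ m)) f)

  SimpOb : Set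
  SimpOb = Ob → ℕ

  SimpHom : SimpOb → SimpOb → Set
  SimpHom F G = ∀ {X Y} → Hom X Y → Lin (F X) (G Y)

  _≈S_ : ∀ {F G} → SimpHom F G → SimpHom F G → Set
  α ≈S β = ∀ {X Y} (φ : Hom X Y) → α φ ≈L β φ

  idS : ∀ F → SimpHom F F
  idS F {X} {Y} φ k i with X ≟ Y
  ... | yes refl = δ φ (idm X) *ℚ δ k i
  ... | no  _    = 0ℚ

  _∘S_ : ∀ {F G H} → SimpHom G H → SimpHom F G → SimpHom F H
  (β ∘S α) {X} {Z} φ k i =
    Σℚ nOb (λ Y →
      Σℚ (nHom X Y) (λ φ₁ →
        Σℚ (nHom Y Z) (λ φ₂ →
          δ (comp φ₂ φ₁) φ *ℚ (β φ₂ ∘L α φ₁) k i)))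

  -- ν(F)(Q) = ⊕_X ⊕_{a : X → Q} F(X); its dimension
  νdim : SimpOb → Ob → ℕ
  νdim F Q = Σℕ nOb (λ X → Σℕ (nHom X Q) (λ _ → F X))

  νIdx : SimpOb → Ob → Set
  νIdx F Q = Σ Ob (λ X → Hom X Q × Fin (F X))

  νdecode : ∀ F Q → Fin (νdim F Q) → νIdx F Q
  νdecode F Q k with unΣ nOb (λ X → Σℕ (nHom X Q) (λ _ → F X)) k
  ... | X , k' with unΣ (nHom X Q) (λ _ → F X) k'
  ...   | a , i = X , a , i

  -- for ψ : Q' → Q, ν(F)(ψ) : (v_a)_{a : X → Q} ↦ (v_{ψ ∘ b})_{b : X → Q'}
  νactEntry : ∀ F {Q' Q} → Hom Q' Q → νIdx F Q' → νIdx F Q → ℚ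
  νactEntry F ψ (X , b , i) (X' , a , i') with X ≟ X'
  ... | yes refl = δ a (comp ψ b) *ℚ δ i i'
  ... | no  _    = 0ℚ

  νOb : SimpOb → RawPresheaf
  dim (νOb F) = νdim F
  act (νOb F) {Q'} {Q} ψ r c = νactEntry F ψ (νdecode F Q' r) (νdecode F Q c)

  -- on morphisms: the family (α(φ))_{φ : X → Y} gives the map
  -- (k_X)_* F(X) → (k_Y)_* G(Y), (v_a)_a ↦ (Σ_φ α(φ) v_{γ ∘ φ})_γ
  νMorEntry : ∀ {F G} → SimpHom F G → ∀ {Q} → νIdx G Q → νIdx F Q → ℚ
  νMorEntry α (Y , γ , j) (X , a , i) =
    Σℚ (nHom X Y) (λ φ → δ (comp γ φ) a *ℚ α φ j i)

  νMor : ∀ {F G} → SimpHom F G → Components (νOb F) (νOb G)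
  νMor {F} {G} α Q r c = νMorEntry α (νdecode G Q r) (νdecode F Q c)

{-# OPTIONS --safe #-}
module Submission where

-- ν(F)(Q) = ⊕_{a : X → Q} F(X) is cofree: a natural map B → ν F is the
-- same as a family of linear maps B(X) → F(X), read off at the indices
-- (X , id_X).  Hence ν is full and faithful, and ν F is injective, since
-- a mono of presheaves is injective at every object (test it on free
-- presheaves) and so has a left inverse there by Gaussian elimination.
--
-- Conversely an injective P is a retract of ν G, where G is P restricted
-- to one object of each isomorphism class, and the retraction gives an
-- idempotent ε of G in Simp(C,V); P ≅ ν F as soon as ε splits.  Since C
-- is semitopological and G lives on pairwise non-isomorphic objects,
-- taking the components at identities is a ring retraction of End(G)
-- onto the product of the matrix rings End(G X), whose kernel raises a
-- height function on objects and is therefore nilpotent.  Idempotents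
-- lift along such retractions, and those of End(G X) split.

open import Algebra.Bundles using (Ring; Semiring)
open import Data.Nat as ℕ using (ℕ; zero; suc; _≤_; _<_; z≤n; s≤s)
open import Data.Product using (Σ; ∃; _×_; _,_; proj₁; proj₂)
open import Level using (0ℓ; _⊔_)
open import Relation.Binary.Bundles using (Setoid)
open import Relation.Binary.Structures using (IsEquivalence)

module Categories where

  record Category : Set₁ where
    infix  4 _≈_
    infixr 9 _∘_
    field
      Obj             : Set
      _⇒_             : Obj → Obj → Set
      _≈_             : ∀ {A B} → A ⇒ B → A ⇒ B → Set
      id              : ∀ {A} → A ⇒ A
      _∘_             : ∀ {A B C} → B ⇒ C → A ⇒ B → A ⇒ C
      ≈-isEquivalence : ∀ {A B} → IsEquivalence (_≈_ {A} {B})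
      ∘-cong          : ∀ {A B C} {g g′ : B ⇒ C} {f f′ : A ⇒ B} → g ≈ g′ → f ≈ f′ → g ∘ f ≈ g′ ∘ f′
      assoc           : ∀ {A B C D} (h : C ⇒ D) (g : B ⇒ C) (f : A ⇒ B) → (h ∘ g) ∘ f ≈ h ∘ (g ∘ f)
      identityˡ       : ∀ {A B} (f : A ⇒ B) → id ∘ f ≈ f
      identityʳ       : ∀ {A B} (f : A ⇒ B) → f ∘ id ≈ f

    hom-setoid : Obj → Obj → Setoid 0ℓ 0ℓ
    hom-setoid A B = record { Carrier = A ⇒ B ; _≈_ = _≈_ ; isEquivalence = ≈-isEquivalence }

    module _ {A B : Obj} where
      open IsEquivalence (≈-isEquivalence {A} {B}) public
        using () renaming (refl to ≈-refl; sym to ≈-sym; trans to ≈-trans)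

    ∘-congˡ : ∀ {A B C} {g : B ⇒ C} {f f′ : A ⇒ B} → f ≈ f′ → g ∘ f ≈ g ∘ f′
    ∘-congˡ = ∘-cong ≈-refl

    ∘-congʳ : ∀ {A B C} {g g′ : B ⇒ C} {f : A ⇒ B} → g ≈ g′ → g ∘ f ≈ g′ ∘ f
    ∘-congʳ g≈g′ = ∘-cong g≈g′ ≈-refl

    Idempotent : ∀ {A} → A ⇒ A → Set
    Idempotent e = e ∘ e ≈ e

    record Splitting {A : Obj} (e : A ⇒ A) : Set where
      field
        {Image} : Obj
        s       : Image ⇒ A
        t       : A ⇒ Image
        t∘s≈id  : t ∘ s ≈ id
        s∘t≈e   : s ∘ t ≈ e

    IdempotentsSplit : Obj → Set
    IdempotentsSplit A = ∀ (e : A ⇒ A) → Idempotent e → Splitting e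

    record _≅_ (A B : Obj) : Set where
      field
        from : A ⇒ B
        to   : B ⇒ A
        isoˡ : to ∘ from ≈ id
        isoʳ : from ∘ to ≈ id

    splitting-conjugate : ∀ {A} {e e′ u w : A ⇒ A} → w ∘ u ≈ id → u ∘ w ≈ id → u ∘ e ≈ e′ ∘ u →
                          Splitting e → Splitting e′
    splitting-conjugate {A} {e} {e′} {u} {w} w∘u≈id u∘w≈id u∘e≈e′∘u split = record
      { s = u ∘ s ; t = t ∘ w ; t∘s≈id = t′∘s′≈id ; s∘t≈e = s′∘t′≈e′ }
      where
      open Splitting split
      t′∘s′≈id : (t ∘ w) ∘ (u ∘ s) ≈ id
      t′∘s′≈id = begin
        (t ∘ w) ∘ (u ∘ s) ≈⟨ assoc t w (u ∘ s) ⟩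
        t ∘ (w ∘ (u ∘ s)) ≈⟨ ∘-congˡ (assoc w u s) ⟨
        t ∘ ((w ∘ u) ∘ s) ≈⟨ ∘-congˡ (∘-congʳ w∘u≈id) ⟩
        t ∘ (id ∘ s)      ≈⟨ ∘-congˡ (identityˡ s) ⟩
        t ∘ s             ≈⟨ t∘s≈id ⟩
        id                ∎
        where open import Relation.Binary.Reasoning.Setoid (hom-setoid Image Image)
      s′∘t′≈e′ : (u ∘ s) ∘ (t ∘ w) ≈ e′
      s′∘t′≈e′ = begin
        (u ∘ s) ∘ (t ∘ w) ≈⟨ assoc u s (t ∘ w) ⟩
        u ∘ (s ∘ (t ∘ w)) ≈⟨ ∘-congˡ (assoc s t w) ⟨
        u ∘ ((s ∘ t) ∘ w) ≈⟨ ∘-congˡ (∘-congʳ s∘t≈e) ⟩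
        u ∘ (e ∘ w)       ≈⟨ assoc u e w ⟨
        (u ∘ e) ∘ w       ≈⟨ ∘-congʳ u∘e≈e′∘u ⟩
        (e′ ∘ u) ∘ w      ≈⟨ assoc e′ u w ⟩
        e′ ∘ (u ∘ w)      ≈⟨ ∘-congˡ u∘w≈id ⟩
        e′ ∘ id           ≈⟨ identityʳ e′ ⟩
        e′                ∎
        where open import Relation.Binary.Reasoning.Setoid (hom-setoid A A)

  record Functor (𝒞 𝒟 : Category) : Set where
    private
      module 𝒞 = Category 𝒞
      module 𝒟 = Category 𝒟
    field
      F₀           : 𝒞.Obj → 𝒟.Obj
      F₁           : ∀ {A B} → A 𝒞.⇒ B → F₀ A 𝒟.⇒ F₀ B
      F-resp-≈     : ∀ {A B} {f g : A 𝒞.⇒ B} → f 𝒞.≈ g → F₁ f 𝒟.≈ F₁ g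
      identity     : ∀ {A} → F₁ (𝒞.id {A}) 𝒟.≈ 𝒟.id
      homomorphism : ∀ {A B C} (g : B 𝒞.⇒ C) (f : A 𝒞.⇒ B) → F₁ (g 𝒞.∘ f) 𝒟.≈ F₁ g 𝒟.∘ F₁ f

    Faithful : Set
    Faithful = ∀ {A B} (f g : A 𝒞.⇒ B) → F₁ f 𝒟.≈ F₁ g → f 𝒞.≈ g

    Full : Set
    Full = ∀ {A B} (h : F₀ A 𝒟.⇒ F₀ B) → Σ (A 𝒞.⇒ B) λ f → F₁ f 𝒟.≈ h

  -- A retract P of F A is the image of the idempotent m ∘ r of F A.  By
  -- fullness and faithfulness that idempotent is F ε for an idempotent
  -- ε of A, and F carries a splitting of ε to an isomorphism P ≅ F B.
  module _ {𝒞 𝒟 : Category} (F : Functor 𝒞 𝒟) where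
    private
      module 𝒞 = Category 𝒞
      module 𝒟 = Category 𝒟
    open Functor F
    open 𝒟

    retract-of-image : Faithful → Full → ∀ {A P} → 𝒞.IdempotentsSplit A →
                       (m : P ⇒ F₀ A) (r : F₀ A ⇒ P) → r ∘ m ≈ id → ∃ λ B → P ≅ F₀ B
    retract-of-image faithful full {A} {P} idempotentsSplit m r r∘m≈id = Image , record
      { from = F₁ t ∘ m ; to = r ∘ F₁ s ; isoˡ = to∘from≈id ; isoʳ = from∘to≈id }
      where
      ε : A 𝒞.⇒ A
      ε = proj₁ (full (m ∘ r))
      Fε≈m∘r : F₁ ε ≈ m ∘ r
      Fε≈m∘r = proj₂ (full (m ∘ r))

      m∘r-idempotent : (m ∘ r) ∘ (m ∘ r) ≈ m ∘ r
      m∘r-idempotent = begin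
        (m ∘ r) ∘ (m ∘ r) ≈⟨ assoc m r (m ∘ r) ⟩
        m ∘ (r ∘ (m ∘ r)) ≈⟨ ∘-congˡ (assoc r m r) ⟨
        m ∘ ((r ∘ m) ∘ r) ≈⟨ ∘-congˡ (∘-congʳ r∘m≈id) ⟩
        m ∘ (id ∘ r)      ≈⟨ ∘-congˡ (identityˡ r) ⟩
        m ∘ r             ∎
        where open import Relation.Binary.Reasoning.Setoid (hom-setoid (F₀ A) (F₀ A))

      ε-idempotent : ε 𝒞.∘ ε 𝒞.≈ ε
      ε-idempotent = faithful (ε 𝒞.∘ ε) ε (begin
        F₁ (ε 𝒞.∘ ε)    ≈⟨ homomorphism ε ε ⟩
        F₁ ε ∘ F₁ ε     ≈⟨ ∘-cong Fε≈m∘r Fε≈m∘r ⟩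
        (m ∘ r) ∘ (m ∘ r) ≈⟨ m∘r-idempotent ⟩
        m ∘ r           ≈⟨ Fε≈m∘r ⟨
        F₁ ε            ∎)
        where open import Relation.Binary.Reasoning.Setoid (hom-setoid (F₀ A) (F₀ A))

      open 𝒞.Splitting (idempotentsSplit ε ε-idempotent)

      to∘from≈id : (r ∘ F₁ s) ∘ (F₁ t ∘ m) ≈ id
      to∘from≈id = begin
        (r ∘ F₁ s) ∘ (F₁ t ∘ m)   ≈⟨ assoc r (F₁ s) (F₁ t ∘ m) ⟩
        r ∘ (F₁ s ∘ (F₁ t ∘ m))   ≈⟨ ∘-congˡ (assoc (F₁ s) (F₁ t) m) ⟨
        r ∘ ((F₁ s ∘ F₁ t) ∘ m)   ≈⟨ ∘-congˡ (∘-congʳ (homomorphism s t)) ⟨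
        r ∘ (F₁ (s 𝒞.∘ t) ∘ m)    ≈⟨ ∘-congˡ (∘-congʳ (≈-trans (F-resp-≈ s∘t≈e) Fε≈m∘r)) ⟩
        r ∘ ((m ∘ r) ∘ m)         ≈⟨ ∘-congˡ (assoc m r m) ⟩
        r ∘ (m ∘ (r ∘ m))         ≈⟨ assoc r m (r ∘ m) ⟨
        (r ∘ m) ∘ (r ∘ m)         ≈⟨ ∘-cong r∘m≈id r∘m≈id ⟩
        id ∘ id                   ≈⟨ identityˡ id ⟩
        id                        ∎
        where open import Relation.Binary.Reasoning.Setoid (hom-setoid P P)

      t∘ε∘s≈id : t 𝒞.∘ (ε 𝒞.∘ s) 𝒞.≈ 𝒞.id
      t∘ε∘s≈id = begin
        t 𝒞.∘ (ε 𝒞.∘ s)          ≈⟨ 𝒞.∘-congˡ (𝒞.∘-congʳ s∘t≈e) ⟨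
        t 𝒞.∘ ((s 𝒞.∘ t) 𝒞.∘ s)  ≈⟨ 𝒞.∘-congˡ (𝒞.assoc s t s) ⟩
        t 𝒞.∘ (s 𝒞.∘ (t 𝒞.∘ s))  ≈⟨ 𝒞.∘-congˡ (𝒞.∘-congˡ t∘s≈id) ⟩
        t 𝒞.∘ (s 𝒞.∘ 𝒞.id)       ≈⟨ 𝒞.∘-congˡ (𝒞.identityʳ s) ⟩
        t 𝒞.∘ s                  ≈⟨ t∘s≈id ⟩
        𝒞.id                     ∎
        where open import Relation.Binary.Reasoning.Setoid (𝒞.hom-setoid Image Image)

      from∘to≈id : (F₁ t ∘ m) ∘ (r ∘ F₁ s) ≈ id
      from∘to≈id = begin
        (F₁ t ∘ m) ∘ (r ∘ F₁ s)   ≈⟨ assoc (F₁ t) m (r ∘ F₁ s) ⟩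
        F₁ t ∘ (m ∘ (r ∘ F₁ s))   ≈⟨ ∘-congˡ (assoc m r (F₁ s)) ⟨
        F₁ t ∘ ((m ∘ r) ∘ F₁ s)   ≈⟨ ∘-congˡ (∘-congʳ Fε≈m∘r) ⟨
        F₁ t ∘ (F₁ ε ∘ F₁ s)      ≈⟨ ∘-congˡ (homomorphism ε s) ⟨
        F₁ t ∘ F₁ (ε 𝒞.∘ s)       ≈⟨ homomorphism t (ε 𝒞.∘ s) ⟨
        F₁ (t 𝒞.∘ (ε 𝒞.∘ s))      ≈⟨ F-resp-≈ t∘ε∘s≈id ⟩
        F₁ 𝒞.id                   ≈⟨ identity ⟩
        id                        ∎
        where open import Relation.Binary.Reasoning.Setoid (hom-setoid (F₀ Image) (F₀ Image))

module UnitsAndIdempotents {c ℓ} (R : Ring c ℓ) where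

  open Ring R
  open import Algebra.Definitions.RawSemiring (Semiring.rawSemiring semiring) using (_^_)
  open import Algebra.Properties.Ring R using (-0#≈0#; ⁻¹-anti-homo‿-; xyx⁻¹≈y; x[y-z]≈xy-xz; [y-z]x≈yx-zx)
  open import Relation.Binary.Reasoning.Setoid setoid

  module _ {x : Carrier} (x*x≈x : x * x ≈ x) where

    x*[1-x]≈0 : x * (1# - x) ≈ 0#
    x*[1-x]≈0 = begin
      x * (1# - x)      ≈⟨ x[y-z]≈xy-xz x 1# x ⟩
      x * 1# - x * x    ≈⟨ +-cong (*-identityʳ x) (-‿cong x*x≈x) ⟩
      x - x             ≈⟨ -‿inverseʳ x ⟩
      0#                ∎

    [1-x]*x≈0 : (1# - x) * x ≈ 0#
    [1-x]*x≈0 = begin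
      (1# - x) * x      ≈⟨ [y-z]x≈yx-zx x 1# x ⟩
      1# * x - x * x    ≈⟨ +-cong (*-identityˡ x) (-‿cong x*x≈x) ⟩
      x - x             ≈⟨ -‿inverseʳ x ⟩
      0#                ∎

    x*x+[1-x]*[1-x]≈1 : x * x + (1# - x) * (1# - x) ≈ 1#
    x*x+[1-x]*[1-x]≈1 = begin
      x * x + (1# - x) * (1# - x)           ≈⟨ +-cong x*x≈x (x[y-z]≈xy-xz (1# - x) 1# x) ⟩
      x + ((1# - x) * 1# - (1# - x) * x)    ≈⟨ +-congˡ (+-cong (*-identityʳ (1# - x)) (-‿cong [1-x]*x≈0)) ⟩
      x + ((1# - x) - 0#)                   ≈⟨ +-congˡ (+-congˡ -0#≈0#) ⟩
      x + ((1# - x) + 0#)                   ≈⟨ +-congˡ (+-identityʳ (1# - x)) ⟩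
      x + (1# - x)                          ≈⟨ +-comm x (1# - x) ⟩
      1# - x + x                            ≈⟨ +-assoc 1# (- x) x ⟩
      1# + (- x + x)                        ≈⟨ +-congˡ (-‿inverseˡ x) ⟩
      1# + 0#                               ≈⟨ +-identityʳ 1# ⟩
      1#                                    ∎

  -- Both sides equal e d.
  idempotent-conjugator : ∀ {e d} → e * e ≈ e → d * d ≈ d →
                          (e * d + (1# - e) * (1# - d)) * d ≈ e * (e * d + (1# - e) * (1# - d))
  idempotent-conjugator {e} {d} e*e≈e d*d≈d = begin
    (e * d + (1# - e) * (1# - d)) * d       ≈⟨ distribʳ d (e * d) ((1# - e) * (1# - d)) ⟩
    e * d * d + (1# - e) * (1# - d) * d     ≈⟨ +-cong (*-assoc e d d) (*-assoc (1# - e) (1# - d) d) ⟩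
    e * (d * d) + (1# - e) * ((1# - d) * d) ≈⟨ +-cong (*-congˡ d*d≈d) (*-congˡ ([1-x]*x≈0 d*d≈d)) ⟩
    e * d + (1# - e) * 0#                   ≈⟨ +-congˡ (zeroʳ (1# - e)) ⟩
    e * d + 0#                              ≈⟨ +-congˡ (zeroˡ (1# - d)) ⟨
    e * d + 0# * (1# - d)                   ≈⟨ +-cong (*-congʳ e*e≈e) (*-congʳ (x*[1-x]≈0 e*e≈e)) ⟨
    e * e * d + e * (1# - e) * (1# - d)     ≈⟨ +-cong (*-assoc e e d) (*-assoc e (1# - e) (1# - d)) ⟩
    e * (e * d) + e * ((1# - e) * (1# - d)) ≈⟨ distribˡ e (e * d) ((1# - e) * (1# - d)) ⟨
    e * (e * d + (1# - e) * (1# - d))       ∎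

  geometric : Carrier → ℕ → Carrier
  geometric x zero    = 0#
  geometric x (suc n) = 1# + x * geometric x n

  geometric-inverse : ∀ x n → x ^ n ≈ 0# →
    (geometric x n * (1# - x) ≈ 1#) × ((1# - x) * geometric x n ≈ 1#)
  geometric-inverse x n xⁿ≈0 = trans (g*[1-x] n) 1-xⁿ≈1 , trans ([1-x]*g n) 1-xⁿ≈1
    where
    g : ℕ → Carrier
    g = geometric x

    1-xⁿ≈1 : 1# - x ^ n ≈ 1#
    1-xⁿ≈1 = begin
      1# - x ^ n ≈⟨ +-congˡ (-‿cong xⁿ≈0) ⟩
      1# - 0#    ≈⟨ +-congˡ -0#≈0# ⟩
      1# + 0#    ≈⟨ +-identityʳ 1# ⟩
      1#         ∎

    telescope : ∀ n → 1# - x + x * (1# - x ^ n) ≈ 1# - x ^ suc n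
    telescope n = begin
      1# - x + x * (1# - x ^ n)       ≈⟨ +-congˡ (x[y-z]≈xy-xz x 1# (x ^ n)) ⟩
      1# - x + (x * 1# - x * x ^ n)   ≈⟨ +-congˡ (+-congʳ (*-identityʳ x)) ⟩
      1# - x + (x - x * x ^ n)        ≈⟨ +-assoc 1# (- x) (x - x * x ^ n) ⟩
      1# + (- x + (x - x * x ^ n))    ≈⟨ +-congˡ (+-assoc (- x) x (- (x * x ^ n))) ⟨
      1# + ((- x + x) - x * x ^ n)    ≈⟨ +-congˡ (+-congʳ (-‿inverseˡ x)) ⟩
      1# + (0# - x * x ^ n)           ≈⟨ +-congˡ (+-identityˡ (- (x * x ^ n))) ⟩
      1# - x ^ suc n                  ∎

    [1-x]*g : ∀ n → (1# - x) * g n ≈ 1# - x ^ n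
    [1-x]*g zero    = trans (zeroʳ (1# - x)) (sym (-‿inverseʳ 1#))
    [1-x]*g (suc n) = begin
      (1# - x) * (1# + x * g n)             ≈⟨ distribˡ (1# - x) 1# (x * g n) ⟩
      (1# - x) * 1# + (1# - x) * (x * g n)  ≈⟨ +-cong (*-identityʳ (1# - x)) (sym (*-assoc (1# - x) x (g n))) ⟩
      1# - x + (1# - x) * x * g n           ≈⟨ +-congˡ (*-congʳ [1-x]*x≈x*[1-x]) ⟩
      1# - x + x * (1# - x) * g n           ≈⟨ +-congˡ (*-assoc x (1# - x) (g n)) ⟩
      1# - x + x * ((1# - x) * g n)         ≈⟨ +-congˡ (*-congˡ ([1-x]*g n)) ⟩
      1# - x + x * (1# - x ^ n)             ≈⟨ telescope n ⟩
      1# - x ^ suc n                        ∎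
      where
      [1-x]*x≈x*[1-x] : (1# - x) * x ≈ x * (1# - x)
      [1-x]*x≈x*[1-x] = begin
        (1# - x) * x     ≈⟨ [y-z]x≈yx-zx x 1# x ⟩
        1# * x - x * x   ≈⟨ +-congʳ (trans (*-identityˡ x) (sym (*-identityʳ x))) ⟩
        x * 1# - x * x   ≈⟨ x[y-z]≈xy-xz x 1# x ⟨
        x * (1# - x)     ∎

    g*[1-x] : ∀ n → g n * (1# - x) ≈ 1# - x ^ n
    g*[1-x] zero    = trans (zeroˡ (1# - x)) (sym (-‿inverseʳ 1#))
    g*[1-x] (suc n) = begin
      (1# + x * g n) * (1# - x)             ≈⟨ distribʳ (1# - x) 1# (x * g n) ⟩
      1# * (1# - x) + x * g n * (1# - x)    ≈⟨ +-cong (*-identityˡ (1# - x)) (*-assoc x (g n) (1# - x)) ⟩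
      1# - x + x * (g n * (1# - x))         ≈⟨ +-congˡ (*-congˡ (g*[1-x] n)) ⟩
      1# - x + x * (1# - x ^ n)             ≈⟨ telescope n ⟩
      1# - x ^ suc n                        ∎

  1-[1-x]≈x : ∀ x → 1# - (1# - x) ≈ x
  1-[1-x]≈x x = begin
    1# - (1# - x)  ≈⟨ +-congˡ (⁻¹-anti-homo‿- 1# x) ⟩
    1# + (x - 1#)  ≈⟨ +-assoc 1# x (- 1#) ⟨
    1# + x - 1#    ≈⟨ xyx⁻¹≈y 1# x ⟩
    x              ∎

  unipotent⇒invertible : ∀ u n → (1# - u) ^ n ≈ 0# → ∃ λ w → w * u ≈ 1# × u * w ≈ 1#
  unipotent⇒invertible u n [1-u]ⁿ≈0 with geometric-inverse (1# - u) n [1-u]ⁿ≈0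
  ... | g*[1-x]≈1 , [1-x]*g≈1 =
    geometric (1# - u) n , trans (*-congˡ (sym (1-[1-x]≈x u))) g*[1-x]≈1 , trans (*-congʳ (sym (1-[1-x]≈x u))) [1-x]*g≈1

  -- Idempotents lift along a retraction π of rings whose kernel is nil:
  -- for d = π e the element u = e d + (1 - e)(1 - d) has π u = 1, hence
  -- is a unit, and it conjugates d into e.
  module IdempotentLifting
    (π : Carrier → Carrier) (π-cong : ∀ {x y} → x ≈ y → π x ≈ π y)
    (π-+ : ∀ x y → π (x + y) ≈ π x + π y) (π-* : ∀ x y → π (x * y) ≈ π x * π y)
    (π-neg : ∀ x → π (- x) ≈ - π x) (π-1# : π 1# ≈ 1#) (π-π : ∀ x → π (π x) ≈ π x)
    (n : ℕ) (kernel-nilpotent : ∀ x → π x ≈ 0# → x ^ n ≈ 0#) where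

    π[1-x] : ∀ x → π (1# - x) ≈ 1# - π x
    π[1-x] x = trans (π-+ 1# (- x)) (+-cong π-1# (π-neg x))

    record Conjugator (e : Carrier) : Set (c ⊔ ℓ) where
      field
        u w      : Carrier
        w*u≈1    : w * u ≈ 1#
        u*w≈1    : u * w ≈ 1#
        u*πe≈e*u : u * π e ≈ e * u

    lift : ∀ {e} → e * e ≈ e → Conjugator e
    lift {e} e*e≈e = record
      { u = u ; w = proj₁ u-invertible ; w*u≈1 = proj₁ (proj₂ u-invertible) ; u*w≈1 = proj₂ (proj₂ u-invertible)
      ; u*πe≈e*u = idempotent-conjugator e*e≈e d*d≈d }
      where
      d : Carrier
      d = π e

      d*d≈d : d * d ≈ d
      d*d≈d = trans (sym (π-* e e)) (π-cong e*e≈e)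

      u : Carrier
      u = e * d + (1# - e) * (1# - d)

      πu≈1 : π u ≈ 1#
      πu≈1 = begin
        π u                                   ≈⟨ π-+ (e * d) ((1# - e) * (1# - d)) ⟩
        π (e * d) + π ((1# - e) * (1# - d))   ≈⟨ +-cong (π-* e d) (π-* (1# - e) (1# - d)) ⟩
        d * π d + π (1# - e) * π (1# - d)     ≈⟨ +-cong (*-congˡ (π-π e)) (*-cong (π[1-x] e) (trans (π[1-x] d) (+-congˡ (-‿cong (π-π e))))) ⟩
        d * d + (1# - d) * (1# - d)           ≈⟨ x*x+[1-x]*[1-x]≈1 d*d≈d ⟩
        1#                                    ∎

      π[1-u]≈0 : π (1# - u) ≈ 0#
      π[1-u]≈0 = begin
        π (1# - u)  ≈⟨ π[1-x] u ⟩
        1# - π u    ≈⟨ +-congˡ (-‿cong πu≈1) ⟩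
        1# - 1#     ≈⟨ -‿inverseʳ 1# ⟩
        0#          ∎

      u-invertible : ∃ λ w → w * u ≈ 1# × u * w ≈ 1#
      u-invertible = unipotent⇒invertible u n (kernel-nilpotent (1# - u) π[1-u]≈0)

open Categories

open import Defs
open import Algebra.Structures using (IsAbelianGroup)
import Data.Nat.Properties as ℕₚ
open import Data.Fin as Fin using (Fin; zero; suc; splitAt; _↑ˡ_; _↑ʳ_)
open import Data.Fin.Properties as Finₚ using (suc-injective; splitAt-↑ˡ; splitAt-↑ʳ; splitAt⁻¹-↑ˡ; splitAt⁻¹-↑ʳ; any?; all?; ¬∀⟶∃¬)
open import Data.Fin.Induction using (<-wellFounded)
open import Data.Rational as ℚ using (ℚ; 0ℚ; 1ℚ; _+_; _*_; -_; _-_; 1/_)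
open import Data.Rational.Properties
open import Data.Rational.Solver using (module +-*-Solver)
open import Data.Product.Properties using (≡-dec)
open import Data.Sum using (_⊎_; inj₁; inj₂)
open import Data.Empty using (⊥-elim)
open import Function using (_∘_)
open import Induction.WellFounded using (Acc; acc)
open import Relation.Binary.Definitions using (tri<; tri≈; tri>)
open import Relation.Binary.PropositionalEquality
open import Relation.Nullary using (yes; no; ¬_; Dec)
open import Relation.Nullary.Decidable using (_×-dec_; ¬?)
open import Relation.Unary using (Pred; Decidable)
open import Algebra.Properties.Semiring.Sum (Ring.semiring +-*-ring)
  using (sum; sum-cong-≗; sum-replicate-zero; ∑-distrib-+; ∑-comm; *-distribˡ-sum; *-distribʳ-sum)

module FiniteSum where

  open ≡-Reasoning

  δ-refl : ∀ {n} (i : Fin n) → δ i i ≡ 1ℚ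
  δ-refl i with i Fin.≟ i
  ... | yes _ = refl
  ... | no i≢i = ⊥-elim (i≢i refl)

  δ-≢ : ∀ {n} {i j : Fin n} → i ≢ j → δ i j ≡ 0ℚ
  δ-≢ {i = i} {j} i≢j with i Fin.≟ j
  ... | yes i≡j = ⊥-elim (i≢j i≡j)
  ... | no _ = refl

  δ-sym : ∀ {n} (i j : Fin n) → δ i j ≡ δ j i
  δ-sym i j = from (i Fin.≟ j)
    where
    from : Dec (i ≡ j) → δ i j ≡ δ j i
    from (yes refl) = refl
    from (no i≢j)   = trans (δ-≢ i≢j) (sym (δ-≢ (i≢j ∘ sym)))

  δ-suc : ∀ {n} (i j : Fin n) → δ (suc i) (suc j) ≡ δ i j
  δ-suc i j = from (i Fin.≟ j)
    where
    from : Dec (i ≡ j) → δ (suc i) (suc j) ≡ δ i j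
    from (yes refl) = trans (δ-refl (suc i)) (sym (δ-refl i))
    from (no i≢j)   = trans (δ-≢ (i≢j ∘ suc-injective)) (sym (δ-≢ i≢j))

  δ-zero-suc : ∀ {n} (j : Fin n) → δ zero (suc j) ≡ 0ℚ
  δ-zero-suc j = δ-≢ {i = zero} {j = suc j} λ ()

  δ-suc-zero : ∀ {n} (j : Fin n) → δ (suc j) zero ≡ 0ℚ
  δ-suc-zero j = δ-≢ {i = suc j} {j = zero} λ ()

  δ*δ-≢ : ∀ {m n} {b a : Fin m} {i i′ : Fin n} → (b , i) ≢ (a , i′) → δ b a * δ i i′ ≡ 0ℚ
  δ*δ-≢ {b = b} {a} {i} {i′} bi≢ai′ = from (b Fin.≟ a)
    where
    from : Dec (b ≡ a) → δ b a * δ i i′ ≡ 0ℚ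
    from (yes refl) = trans (cong (δ b b *_) (δ-≢ {i = i} {i′} λ { refl → bi≢ai′ refl })) (*-zeroʳ (δ b b))
    from (no b≢a)   = trans (cong (_* δ i i′) (δ-≢ b≢a)) (*-zeroˡ (δ i i′))

  Σℚ≡sum : ∀ n (f : Fin n → ℚ) → Σℚ n f ≡ sum f
  Σℚ≡sum zero    f = refl
  Σℚ≡sum (suc n) f = cong (f zero +_) (Σℚ≡sum n (f ∘ suc))

  Σℚ-cong : ∀ n {f g : Fin n → ℚ} → (∀ i → f i ≡ g i) → Σℚ n f ≡ Σℚ n g
  Σℚ-cong n {f} {g} f≗g rewrite Σℚ≡sum n f | Σℚ≡sum n g = sum-cong-≗ f≗g

  Σℚ-zero : ∀ n {f : Fin n → ℚ} → (∀ i → f i ≡ 0ℚ) → Σℚ n f ≡ 0ℚ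
  Σℚ-zero n {f} f≗0 rewrite Σℚ-cong n f≗0 | Σℚ≡sum n (λ _ → 0ℚ) = sum-replicate-zero n

  Σℚ-distrib-+ : ∀ n (f g : Fin n → ℚ) → Σℚ n (λ i → f i + g i) ≡ Σℚ n f + Σℚ n g
  Σℚ-distrib-+ n f g
    rewrite Σℚ≡sum n (λ i → f i + g i) | Σℚ≡sum n f | Σℚ≡sum n g = ∑-distrib-+ f g

  *-distribˡ-Σℚ : ∀ n x (f : Fin n → ℚ) → x * Σℚ n f ≡ Σℚ n (λ i → x * f i)
  *-distribˡ-Σℚ n x f rewrite Σℚ≡sum n f | Σℚ≡sum n (λ i → x * f i) = *-distribˡ-sum x f

  *-distribʳ-Σℚ : ∀ n x (f : Fin n → ℚ) → Σℚ n f * x ≡ Σℚ n (λ i → f i * x)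
  *-distribʳ-Σℚ n x f rewrite Σℚ≡sum n f | Σℚ≡sum n (λ i → f i * x) = *-distribʳ-sum x f

  Σℚ-comm : ∀ n m (f : Fin n → Fin m → ℚ) →
            Σℚ n (λ i → Σℚ m (f i)) ≡ Σℚ m (λ j → Σℚ n (λ i → f i j))
  Σℚ-comm n m f = begin
    Σℚ n (λ i → Σℚ m (f i))            ≡⟨ Σℚ-cong n (λ i → Σℚ≡sum m (f i)) ⟩
    Σℚ n (λ i → sum (f i))             ≡⟨ Σℚ≡sum n _ ⟩
    sum (λ i → sum (f i))              ≡⟨ ∑-comm f ⟩
    sum (λ j → sum (λ i → f i j))      ≡⟨ Σℚ≡sum m _ ⟨
    Σℚ m (λ j → sum (λ i → f i j))     ≡⟨ Σℚ-cong m (λ j → Σℚ≡sum n (λ i → f i j)) ⟨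
    Σℚ m (λ j → Σℚ n (λ i → f i j))    ∎

  neg-distrib-Σℚ : ∀ n (f : Fin n → ℚ) → - Σℚ n f ≡ Σℚ n (λ i → - f i)
  neg-distrib-Σℚ zero    f = refl
  neg-distrib-Σℚ (suc n) f = trans (neg-distrib-+ (f zero) (Σℚ n (f ∘ suc))) (cong (- f zero +_) (neg-distrib-Σℚ n (f ∘ suc)))

  Σℚ-single : ∀ n (x : Fin n) (f : Fin n → ℚ) → (∀ y → x ≢ y → f y ≡ 0ℚ) → Σℚ n f ≡ f x
  Σℚ-single (suc n) zero f f≡0 = begin
    f zero + Σℚ n (f ∘ suc) ≡⟨ cong (f zero +_) (Σℚ-zero n (λ i → f≡0 (suc i) λ ())) ⟩
    f zero + 0ℚ             ≡⟨ +-identityʳ (f zero) ⟩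
    f zero                  ∎
  Σℚ-single (suc n) (suc x) f f≡0 = begin
    f zero + Σℚ n (f ∘ suc)  ≡⟨ cong₂ _+_ (f≡0 zero λ ()) (Σℚ-single n x (f ∘ suc) (λ y x≢y → f≡0 (suc y) (x≢y ∘ suc-injective))) ⟩
    0ℚ + f (suc x)           ≡⟨ +-identityˡ (f (suc x)) ⟩
    f (suc x)                ∎

  Σℚ-δˡ : ∀ n (x : Fin n) (f : Fin n → ℚ) → Σℚ n (λ y → δ x y * f y) ≡ f x
  Σℚ-δˡ n x f = begin
    Σℚ n (λ y → δ x y * f y) ≡⟨ Σℚ-single n x _ (λ y x≢y → trans (cong (_* f y) (δ-≢ x≢y)) (*-zeroˡ (f y))) ⟩
    δ x x * f x              ≡⟨ cong (_* f x) (δ-refl x) ⟩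
    1ℚ * f x                 ≡⟨ *-identityˡ (f x) ⟩
    f x                      ∎

  Σℚ-δʳ : ∀ n (x : Fin n) (f : Fin n → ℚ) → Σℚ n (λ y → f y * δ y x) ≡ f x
  Σℚ-δʳ n x f = trans (Σℚ-cong n (λ y → trans (*-comm (f y) (δ y x)) (cong (_* f y) (δ-sym y x)))) (Σℚ-δˡ n x f)

  Σℚ-++ : ∀ m n (f : Fin (m ℕ.+ n) → ℚ) → Σℚ (m ℕ.+ n) f ≡ Σℚ m (λ i → f (i ↑ˡ n)) + Σℚ n (λ j → f (m ↑ʳ j))
  Σℚ-++ zero    n f = sym (+-identityˡ (Σℚ n f))
  Σℚ-++ (suc m) n f = trans (cong (f zero +_) (Σℚ-++ m n (f ∘ suc)))
                            (sym (+-assoc (f zero) (Σℚ m (λ i → f (suc (i ↑ˡ n)))) (Σℚ n (λ j → f (suc (m ↑ʳ j))))))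

  unΣ⁻¹ : ∀ n (d : Fin n → ℕ) → Σ (Fin n) (λ x → Fin (d x)) → Fin (Σℕ n d)
  unΣ⁻¹ (suc n) d (zero  , i) = i ↑ˡ Σℕ n (d ∘ suc)
  unΣ⁻¹ (suc n) d (suc x , i) = d zero ↑ʳ unΣ⁻¹ n (d ∘ suc) (x , i)

  unΣ-unΣ⁻¹ : ∀ n (d : Fin n → ℕ) p → unΣ n d (unΣ⁻¹ n d p) ≡ p
  unΣ-unΣ⁻¹ (suc n) d (zero , i) rewrite splitAt-↑ˡ (d zero) i (Σℕ n (d ∘ suc)) = refl
  unΣ-unΣ⁻¹ (suc n) d (suc x , i)
    rewrite splitAt-↑ʳ (d zero) (Σℕ n (d ∘ suc)) (unΣ⁻¹ n (d ∘ suc) (x , i))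
          | unΣ-unΣ⁻¹ n (d ∘ suc) (x , i) = refl

  unΣ⁻¹-unΣ : ∀ n (d : Fin n → ℕ) k → unΣ⁻¹ n d (unΣ n d k) ≡ k
  unΣ⁻¹-unΣ (suc n) d k
    with splitAt (d zero) k | splitAt⁻¹-↑ˡ {d zero} {Σℕ n (d ∘ suc)} {k} | splitAt⁻¹-↑ʳ {d zero} {Σℕ n (d ∘ suc)} {k}
  ... | inj₁ i  | ↑ˡ-inverse | _ = ↑ˡ-inverse refl
  ... | inj₂ k′ | _ | ↑ʳ-inverse with unΣ n (d ∘ suc) k′ | unΣ⁻¹-unΣ n (d ∘ suc) k′
  ...   | x , i | IH = trans (cong (d zero ↑ʳ_) IH) (↑ʳ-inverse refl)

  Σℚ-Σℕ : ∀ n (d : Fin n → ℕ) (f : Fin (Σℕ n d) → ℚ) →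
          Σℚ (Σℕ n d) f ≡ Σℚ n (λ x → Σℚ (d x) (λ i → f (unΣ⁻¹ n d (x , i))))
  Σℚ-Σℕ zero    d f = refl
  Σℚ-Σℕ (suc n) d f = trans (Σℚ-++ (d zero) (Σℕ n (d ∘ suc)) f)
    (cong (Σℚ (d zero) (λ i → f (i ↑ˡ _)) +_) (Σℚ-Σℕ n (d ∘ suc) (λ j → f (d zero ↑ʳ j))))

  Σℚ-unΣ : ∀ n (d : Fin n → ℕ) (h : Σ (Fin n) (λ x → Fin (d x)) → ℚ) →
           Σℚ (Σℕ n d) (h ∘ unΣ n d) ≡ Σℚ n (λ x → Σℚ (d x) (λ i → h (x , i)))
  Σℚ-unΣ n d h = trans (Σℚ-Σℕ n d _) (Σℚ-cong n (λ x → Σℚ-cong (d x) (λ i → cong h (unΣ-unΣ⁻¹ n d (x , i)))))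

  δ-unΣ : ∀ n k (r c : Fin (Σℕ n (λ _ → k))) →
          δ r c ≡ δ (proj₁ (unΣ n (λ _ → k) r)) (proj₁ (unΣ n (λ _ → k) c)) * δ (proj₂ (unΣ n (λ _ → k) r)) (proj₂ (unΣ n (λ _ → k) c))
  δ-unΣ n k r c with r Fin.≟ c
  ... | yes refl = sym (trans (cong₂ _*_ (δ-refl (proj₁ (unΣ n _ r))) (δ-refl (proj₂ (unΣ n _ r)))) (*-identityˡ 1ℚ))
  ... | no r≢c   = sym (δ*δ-≢ λ eq → r≢c (trans (sym (unΣ⁻¹-unΣ n _ r)) (trans (cong (unΣ⁻¹ n _) eq) (unΣ⁻¹-unΣ n _ c))))

open FiniteSum

module Matrix where

  Lin-setoid : ℕ → ℕ → Setoid 0ℓ 0ℓ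
  Lin-setoid d e = record
    { Carrier = Lin d e
    ; _≈_ = _≈L_
    ; isEquivalence = record
      { refl = λ _ _ → refl
      ; sym = λ A≈B k i → sym (A≈B k i)
      ; trans = λ A≈B B≈C k i → trans (A≈B k i) (B≈C k i)
      }
    }

  module _ {d e : ℕ} where
    open Setoid (Lin-setoid d e) public
      using () renaming (refl to ≈L-refl; sym to ≈L-sym; trans to ≈L-trans)

  ∘L-cong : ∀ {d e f} {B B′ : Lin e f} {A A′ : Lin d e} → B ≈L B′ → A ≈L A′ → (B ∘L A) ≈L (B′ ∘L A′)
  ∘L-cong {e = e} B≈B′ A≈A′ k i = Σℚ-cong e (λ j → cong₂ _*_ (B≈B′ k j) (A≈A′ j i))

  ∘L-congˡ : ∀ {d e f} {B : Lin e f} {A A′ : Lin d e} → A ≈L A′ → (B ∘L A) ≈L (B ∘L A′)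
  ∘L-congˡ {B = B} = ∘L-cong {B = B} (λ _ _ → refl)

  ∘L-congʳ : ∀ {d e f} {B B′ : Lin e f} {A : Lin d e} → B ≈L B′ → (B ∘L A) ≈L (B′ ∘L A)
  ∘L-congʳ {A = A} B≈B′ = ∘L-cong {A = A} B≈B′ (λ _ _ → refl)

  ∘L-assoc : ∀ {a b c d} (C : Lin c d) (B : Lin b c) (A : Lin a b) → ((C ∘L B) ∘L A) ≈L (C ∘L (B ∘L A))
  ∘L-assoc {b = b} {c = c} C B A k i = begin
    Σℚ b (λ j → Σℚ c (λ l → C k l * B l j) * A j i)
      ≡⟨ Σℚ-cong b (λ j → trans (*-distribʳ-Σℚ c (A j i) _) (Σℚ-cong c (λ l → *-assoc (C k l) (B l j) (A j i)))) ⟩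
    Σℚ b (λ j → Σℚ c (λ l → C k l * (B l j * A j i)))
      ≡⟨ Σℚ-comm b c _ ⟩
    Σℚ c (λ l → Σℚ b (λ j → C k l * (B l j * A j i)))
      ≡⟨ Σℚ-cong c (λ l → *-distribˡ-Σℚ b (C k l) _) ⟨
    Σℚ c (λ l → C k l * Σℚ b (λ j → B l j * A j i)) ∎
    where open ≡-Reasoning

  ∘L-identityˡ : ∀ {d e} (A : Lin d e) → (idL e ∘L A) ≈L A
  ∘L-identityˡ {e = e} A k i = Σℚ-δˡ e k (λ j → A j i)

  ∘L-identityʳ : ∀ {d e} (A : Lin d e) → (A ∘L idL d) ≈L A
  ∘L-identityʳ {d = d} A k i = Σℚ-δʳ d i (A k)

  ∘L-zeroˡ : ∀ {d e f} (A : Lin d e) → (zeroL {e} {f} ∘L A) ≈L zeroL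
  ∘L-zeroˡ {e = e} A k i = Σℚ-zero e (λ j → *-zeroˡ (A j i))

  ∘L-zeroʳ : ∀ {d e f} (B : Lin e f) → (B ∘L zeroL {d} {e}) ≈L zeroL
  ∘L-zeroʳ {e = e} B k i = Σℚ-zero e (λ j → *-zeroʳ (B k j))

  column : ∀ {n} → (Fin n → ℚ) → Lin 1 n
  column v k _ = v k

  _+L_ : ∀ {d e} → Lin d e → Lin d e → Lin d e
  (A +L B) k i = A k i + B k i

  ∘L-distribˡ : ∀ {d e f} (C : Lin e f) (A B : Lin d e) → (C ∘L (A +L B)) ≈L ((C ∘L A) +L (C ∘L B))
  ∘L-distribˡ {e = e} C A B k i = trans (Σℚ-cong e (λ j → *-distribˡ-+ (C k j) (A j i) (B j i))) (Σℚ-distrib-+ e _ _)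

  ∘L-distribʳ : ∀ {d e f} (C : Lin d e) (A B : Lin e f) → ((A +L B) ∘L C) ≈L ((A ∘L C) +L (B ∘L C))
  ∘L-distribʳ {e = e} C A B k i = trans (Σℚ-cong e (λ j → *-distribʳ-+ (C j i) (A k j) (B k j))) (Σℚ-distrib-+ e _ _)

open Matrix

module GaussianElimination where

  record FullRankFactorisation {d e : ℕ} (M : Lin d e) : Set where
    field
      rank  : ℕ
      S     : Lin rank e
      T     : Lin d rank
      L     : Lin e rank
      R     : Lin rank d
      S∘T≈M : (S ∘L T) ≈L M
      L∘S≈I : (L ∘L S) ≈L idL rank
      T∘R≈I : (T ∘L R) ≈L idL rank

  -- One step of Gaussian elimination: M is its first column c next to
  -- a matrix M′ = S T that is already factorised.  If c lies in the
  -- image of S (its residual c - S L c vanishes) only T grows by a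
  -- column; otherwise the residual becomes a new basis vector, the new
  -- row of L being e_{k₀} (I - S L) / residual k₀.
  module AddColumn {d e : ℕ} (M : Lin (suc d) e) (M′ : FullRankFactorisation (λ k i → M k (suc i))) where
    open FullRankFactorisation M′ using (rank; S; T; L; R; S∘T≈M; L∘S≈I; T∘R≈I)
    open ≡-Reasoning

    c : Fin e → ℚ
    c k = M k zero

    w : Fin rank → ℚ
    w j = (L ∘L column c) j zero

    Sw : Fin e → ℚ
    Sw k = (S ∘L column w) k zero

    residual : Fin e → ℚ
    residual k = c k - Sw k

    L∘S∘w≈w : ∀ j → (L ∘L column Sw) j zero ≡ w j
    L∘S∘w≈w j = begin
      (L ∘L (S ∘L column w)) j zero ≡⟨ ∘L-assoc L S (column w) j zero ⟨
      ((L ∘L S) ∘L column w) j zero ≡⟨ ∘L-congʳ {A = column w} L∘S≈I j zero ⟩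
      (idL rank ∘L column w) j zero ≡⟨ ∘L-identityˡ (column w) j zero ⟩
      w j                           ∎

    L∘residual≈0 : (L ∘L column residual) ≈L zeroL
    L∘residual≈0 j _ = begin
      Σℚ e (λ l → L j l * (c l - Sw l))
        ≡⟨ Σℚ-cong e (λ l → trans (*-distribˡ-+ (L j l) (c l) (- Sw l)) (cong (L j l * c l +_) (sym (neg-distribʳ-* (L j l) (Sw l))))) ⟩
      Σℚ e (λ l → L j l * c l - L j l * Sw l)
        ≡⟨ Σℚ-distrib-+ e _ _ ⟩
      w j + Σℚ e (λ l → - (L j l * Sw l))
        ≡⟨ cong (w j +_) (neg-distrib-Σℚ e _) ⟨
      w j - (L ∘L column Sw) j zero
        ≡⟨ cong (λ x → w j - x) (L∘S∘w≈w j) ⟩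
      w j - w j
        ≡⟨ +-inverseʳ (w j) ⟩
      0ℚ ∎

    T⁺ : Lin (suc d) rank
    T⁺ j zero    = w j
    T⁺ j (suc i) = T j i

    c≡residual+Sw : ∀ k → c k ≡ residual k + Sw k
    c≡residual+Sw k = solve 2 (λ x y → x := (x :- y) :+ y) refl (c k) (Sw k)
      where open +-*-Solver

    inImage : (∀ k → residual k ≡ 0ℚ) → FullRankFactorisation M
    inImage residual≡0 = record
      { rank = rank ; S = S ; T = T⁺ ; L = L ; R = R⁺
      ; S∘T≈M = S∘T⁺≈M ; L∘S≈I = L∘S≈I ; T∘R≈I = T⁺∘R⁺≈I }
      where
      R⁺ : Lin rank (suc d)
      R⁺ zero    j = 0ℚ
      R⁺ (suc i) j = R i j
      S∘T⁺≈M : (S ∘L T⁺) ≈L M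
      S∘T⁺≈M k zero    = sym (trans (c≡residual+Sw k) (trans (cong (_+ Sw k) (residual≡0 k)) (+-identityˡ (Sw k))))
      S∘T⁺≈M k (suc i) = S∘T≈M k i
      T⁺∘R⁺≈I : (T⁺ ∘L R⁺) ≈L idL rank
      T⁺∘R⁺≈I j j′ = trans (cong (_+ (T ∘L R) j j′) (*-zeroʳ (w j))) (trans (+-identityˡ _) (T∘R≈I j j′))

    module NewPivot (k₀ : Fin e) (residual≢0 : residual k₀ ≢ 0ℚ) where
      p : ℚ
      p = residual k₀

      instance
        p-nonZero : ℚ.NonZero p
        p-nonZero = ℚ.≢-nonZero residual≢0

      projection : Fin e → ℚ
      projection l = δ k₀ l - (S ∘L L) k₀ l

      projection∘ : ∀ {m} (V : Lin m e) j → Σℚ e (λ l → projection l * V l j) ≡ V k₀ j - (S ∘L (L ∘L V)) k₀ j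
      projection∘ V j = begin
        Σℚ e (λ l → (δ k₀ l - (S ∘L L) k₀ l) * V l j)
          ≡⟨ Σℚ-cong e (λ l → trans (*-distribʳ-+ (V l j) (δ k₀ l) _) (cong (δ k₀ l * V l j +_) (sym (neg-distribˡ-* ((S ∘L L) k₀ l) (V l j))))) ⟩
        Σℚ e (λ l → δ k₀ l * V l j - (S ∘L L) k₀ l * V l j)
          ≡⟨ Σℚ-distrib-+ e _ _ ⟩
        Σℚ e (λ l → δ k₀ l * V l j) + Σℚ e (λ l → - ((S ∘L L) k₀ l * V l j))
          ≡⟨ cong₂ _+_ (Σℚ-δˡ e k₀ (λ l → V l j)) (sym (neg-distrib-Σℚ e _)) ⟩
        V k₀ j - ((S ∘L L) ∘L V) k₀ j
          ≡⟨ cong (λ x → V k₀ j - x) (∘L-assoc S L V k₀ j) ⟩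
        V k₀ j - (S ∘L (L ∘L V)) k₀ j ∎

      S⁺ : Lin (suc rank) e
      S⁺ k zero    = residual k
      S⁺ k (suc j) = S k j

      T⁺⁺ : Lin (suc d) (suc rank)
      T⁺⁺ zero    zero    = 1ℚ
      T⁺⁺ zero    (suc i) = 0ℚ
      T⁺⁺ (suc j) i       = T⁺ j i

      L⁺ : Lin e (suc rank)
      L⁺ zero    l = 1/ p * projection l
      L⁺ (suc j) l = L j l

      R⁺ : Lin (suc rank) (suc d)
      R⁺ zero    zero    = 1ℚ
      R⁺ zero    (suc j) = 0ℚ
      R⁺ (suc i) zero    = - (R ∘L column w) i zero
      R⁺ (suc i) (suc j) = R i j

      S⁺∘T⁺⁺≈M : (S⁺ ∘L T⁺⁺) ≈L M
      S⁺∘T⁺⁺≈M k zero    = trans (cong (_+ Sw k) (*-identityʳ (residual k))) (sym (c≡residual+Sw k))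
      S⁺∘T⁺⁺≈M k (suc i) = trans (cong (_+ (S ∘L T) k i) (*-zeroʳ (residual k))) (trans (+-identityˡ _) (S∘T≈M k i))

      L⁺∘S⁺-row₀ : ∀ j → S⁺ k₀ j - (S ∘L (L ∘L S⁺)) k₀ j ≡ p * δ zero j → (L⁺ ∘L S⁺) zero j ≡ δ zero j
      L⁺∘S⁺-row₀ j eq = begin
        Σℚ e (λ l → 1/ p * projection l * S⁺ l j)   ≡⟨ Σℚ-cong e (λ l → *-assoc (1/ p) (projection l) (S⁺ l j)) ⟩
        Σℚ e (λ l → 1/ p * (projection l * S⁺ l j)) ≡⟨ *-distribˡ-Σℚ e (1/ p) _ ⟨
        1/ p * Σℚ e (λ l → projection l * S⁺ l j)   ≡⟨ cong (1/ p *_) (trans (projection∘ S⁺ j) eq) ⟩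
        1/ p * (p * δ zero j)                      ≡⟨ *-assoc (1/ p) p (δ zero j) ⟨
        1/ p * p * δ zero j                        ≡⟨ cong (_* δ zero j) (*-inverseˡ p) ⟩
        1ℚ * δ zero j                              ≡⟨ *-identityˡ (δ zero j) ⟩
        δ zero j                                   ∎

      L⁺∘S⁺≈I : (L⁺ ∘L S⁺) ≈L idL (suc rank)
      L⁺∘S⁺≈I zero zero = L⁺∘S⁺-row₀ zero (begin
        p - (S ∘L (L ∘L column residual)) k₀ zero
          ≡⟨ cong (λ x → p - x) (trans (∘L-congˡ {B = S} L∘residual≈0 k₀ zero) (∘L-zeroʳ {d = 1} S k₀ zero)) ⟩
        p - 0ℚ   ≡⟨ +-identityʳ p ⟩
        p        ≡⟨ *-identityʳ p ⟨
        p * 1ℚ   ≡⟨ cong (p *_) (δ-refl (zero {rank})) ⟨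
        p * δ (zero {rank}) zero ∎)
      L⁺∘S⁺≈I zero (suc j) = L⁺∘S⁺-row₀ (suc j) (begin
        S k₀ j - (S ∘L (L ∘L S)) k₀ j  ≡⟨ cong (λ x → S k₀ j - x) (trans (∘L-congˡ {B = S} L∘S≈I k₀ j) (∘L-identityʳ S k₀ j)) ⟩
        S k₀ j - S k₀ j                ≡⟨ +-inverseʳ (S k₀ j) ⟩
        0ℚ                             ≡⟨ *-zeroʳ p ⟨
        p * 0ℚ                         ≡⟨ cong (p *_) (δ-zero-suc j) ⟨
        p * δ zero (suc j)             ∎)
      L⁺∘S⁺≈I (suc j) zero     = trans (L∘residual≈0 j zero) (sym (δ-suc-zero j))
      L⁺∘S⁺≈I (suc j) (suc j′) = trans (L∘S≈I j j′) (sym (δ-suc j j′))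

      T⁺⁺∘R⁺≈I : (T⁺⁺ ∘L R⁺) ≈L idL (suc rank)
      T⁺⁺∘R⁺≈I zero zero = begin
        1ℚ * 1ℚ + Σℚ d (λ i → 0ℚ * R⁺ (suc i) zero) ≡⟨ cong (1ℚ * 1ℚ +_) (Σℚ-zero d (λ i → *-zeroˡ (R⁺ (suc i) zero))) ⟩
        1ℚ * 1ℚ + 0ℚ                 ≡⟨ sym (δ-refl (zero {rank})) ⟩
        δ (zero {rank}) zero         ∎
      T⁺⁺∘R⁺≈I zero (suc j′) = trans (cong₂ _+_ (*-zeroʳ 1ℚ) (Σℚ-zero d (λ i → *-zeroˡ (R i j′)))) (sym (δ-zero-suc j′))
      T⁺⁺∘R⁺≈I (suc j) zero = begin
        w j * 1ℚ + Σℚ d (λ i → T j i * - (R ∘L column w) i zero)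
          ≡⟨ cong₂ _+_ (*-identityʳ (w j)) (trans (Σℚ-cong d (λ i → sym (neg-distribʳ-* (T j i) _))) (sym (neg-distrib-Σℚ d _))) ⟩
        w j - (T ∘L (R ∘L column w)) j zero
          ≡⟨ cong (λ x → w j - x) (trans (sym (∘L-assoc T R (column w) j zero)) (trans (∘L-congʳ {A = column w} T∘R≈I j zero) (∘L-identityˡ (column w) j zero))) ⟩
        w j - w j
          ≡⟨ +-inverseʳ (w j) ⟩
        0ℚ
          ≡⟨ δ-suc-zero j ⟨
        δ (suc j) zero ∎
      T⁺⁺∘R⁺≈I (suc j) (suc j′) =
        trans (cong (_+ (T ∘L R) j j′) (*-zeroʳ (w j))) (trans (+-identityˡ _) (trans (T∘R≈I j j′) (sym (δ-suc j j′))))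

      factorisation : FullRankFactorisation M
      factorisation = record
        { rank = suc rank ; S = S⁺ ; T = T⁺⁺ ; L = L⁺ ; R = R⁺
        ; S∘T≈M = S⁺∘T⁺⁺≈M ; L∘S≈I = L⁺∘S⁺≈I ; T∘R≈I = T⁺⁺∘R⁺≈I }

    factorisation : FullRankFactorisation M
    factorisation with all? (λ k → residual k ℚ.≟ 0ℚ)
    ... | yes residual≡0 = inImage residual≡0
    ... | no residual≢0  = NewPivot.factorisation (proj₁ pivot) (proj₂ pivot)
      where
      pivot : ∃ λ k₀ → residual k₀ ≢ 0ℚ
      pivot = ¬∀⟶∃¬ e _ (λ k → residual k ℚ.≟ 0ℚ) residual≢0

  fullRankFactorisation : ∀ {d e} (M : Lin d e) → FullRankFactorisation M
  fullRankFactorisation {zero} M = record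
    { rank = 0 ; S = λ _ () ; T = λ () ; L = λ () ; R = λ _ ()
    ; S∘T≈M = λ _ () ; L∘S≈I = λ () ; T∘R≈I = λ () }
  fullRankFactorisation {suc d} M = AddColumn.factorisation M (fullRankFactorisation (λ k i → M k (suc i)))

  record IdempotentSplitting {n : ℕ} (E : Lin n n) : Set where
    field
      rank  : ℕ
      S     : Lin rank n
      T     : Lin n rank
      T∘S≈I : (T ∘L S) ≈L idL rank
      S∘T≈E : (S ∘L T) ≈L E

  splitIdempotent : ∀ {n} (E : Lin n n) → (E ∘L E) ≈L E → IdempotentSplitting E
  splitIdempotent {n} E E∘E≈E = record { rank = rank ; S = S ; T = T ; T∘S≈I = T∘S≈I ; S∘T≈E = S∘T≈M }
    where
    open FullRankFactorisation (fullRankFactorisation E)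

    L∘[S∘X∘T]∘R≈X : ∀ (X : Lin rank rank) → ((L ∘L ((S ∘L X) ∘L T)) ∘L R) ≈L X
    L∘[S∘X∘T]∘R≈X X = begin
      (L ∘L ((S ∘L X) ∘L T)) ∘L R  ≈⟨ ∘L-congʳ {A = R} (∘L-assoc L (S ∘L X) T) ⟨
      ((L ∘L (S ∘L X)) ∘L T) ∘L R  ≈⟨ ∘L-assoc (L ∘L (S ∘L X)) T R ⟩
      (L ∘L (S ∘L X)) ∘L (T ∘L R)  ≈⟨ ∘L-congˡ {B = L ∘L (S ∘L X)} T∘R≈I ⟩
      (L ∘L (S ∘L X)) ∘L idL rank  ≈⟨ ∘L-identityʳ (L ∘L (S ∘L X)) ⟩
      L ∘L (S ∘L X)                ≈⟨ ∘L-assoc L S X ⟨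
      (L ∘L S) ∘L X                ≈⟨ ∘L-congʳ {A = X} L∘S≈I ⟩
      idL rank ∘L X                ≈⟨ ∘L-identityˡ X ⟩
      X                            ∎
      where open import Relation.Binary.Reasoning.Setoid (Lin-setoid rank rank)

    S∘[T∘S]∘T≈S∘I∘T : ((S ∘L (T ∘L S)) ∘L T) ≈L ((S ∘L idL rank) ∘L T)
    S∘[T∘S]∘T≈S∘I∘T = begin
      (S ∘L (T ∘L S)) ∘L T  ≈⟨ ∘L-congʳ {A = T} (∘L-assoc S T S) ⟨
      ((S ∘L T) ∘L S) ∘L T  ≈⟨ ∘L-assoc (S ∘L T) S T ⟩
      (S ∘L T) ∘L (S ∘L T)  ≈⟨ ∘L-cong S∘T≈M S∘T≈M ⟩
      E ∘L E                ≈⟨ E∘E≈E ⟩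
      E                     ≈⟨ S∘T≈M ⟨
      S ∘L T                ≈⟨ ∘L-congʳ {A = T} (∘L-identityʳ S) ⟨
      (S ∘L idL rank) ∘L T  ∎
      where open import Relation.Binary.Reasoning.Setoid (Lin-setoid n n)

    T∘S≈I : (T ∘L S) ≈L idL rank
    T∘S≈I = begin
      T ∘L S                              ≈⟨ L∘[S∘X∘T]∘R≈X (T ∘L S) ⟨
      (L ∘L ((S ∘L (T ∘L S)) ∘L T)) ∘L R  ≈⟨ ∘L-congʳ {A = R} (∘L-congˡ {B = L} S∘[T∘S]∘T≈S∘I∘T) ⟩
      (L ∘L ((S ∘L idL rank) ∘L T)) ∘L R  ≈⟨ L∘[S∘X∘T]∘R≈X (idL rank) ⟩
      idL rank                            ∎
      where open import Relation.Binary.Reasoning.Setoid (Lin-setoid rank rank)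

  LeftCancellative : ∀ {d e} → Lin d e → Set
  LeftCancellative {d} M = ∀ {k} (N N′ : Lin k d) → (M ∘L N) ≈L (M ∘L N′) → N ≈L N′

  leftInverse : ∀ {d e} (M : Lin d e) → LeftCancellative M → Σ (Lin e d) (λ K → (K ∘L M) ≈L idL d)
  leftInverse {d} {e} M cancel = R ∘L L , K∘M≈I
    where
    open FullRankFactorisation (fullRankFactorisation M)
    R∘T≈I : (R ∘L T) ≈L idL d
    R∘T≈I = cancel (R ∘L T) (idL d) (begin
      M ∘L (R ∘L T)          ≈⟨ ∘L-congʳ {A = R ∘L T} S∘T≈M ⟨
      (S ∘L T) ∘L (R ∘L T)   ≈⟨ ∘L-assoc S T (R ∘L T) ⟩
      S ∘L (T ∘L (R ∘L T))   ≈⟨ ∘L-congˡ {B = S} (∘L-assoc T R T) ⟨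
      S ∘L ((T ∘L R) ∘L T)   ≈⟨ ∘L-congˡ {B = S} (∘L-congʳ {A = T} T∘R≈I) ⟩
      S ∘L (idL rank ∘L T)   ≈⟨ ∘L-congˡ {B = S} (∘L-identityˡ T) ⟩
      S ∘L T                 ≈⟨ S∘T≈M ⟩
      M                      ≈⟨ ∘L-identityʳ M ⟨
      M ∘L idL d             ∎)
      where open import Relation.Binary.Reasoning.Setoid (Lin-setoid d e)
    K∘M≈I : ((R ∘L L) ∘L M) ≈L idL d
    K∘M≈I = begin
      (R ∘L L) ∘L M          ≈⟨ ∘L-congˡ {B = R ∘L L} S∘T≈M ⟨
      (R ∘L L) ∘L (S ∘L T)   ≈⟨ ∘L-assoc R L (S ∘L T) ⟩
      R ∘L (L ∘L (S ∘L T))   ≈⟨ ∘L-congˡ {B = R} (∘L-assoc L S T) ⟨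
      R ∘L ((L ∘L S) ∘L T)   ≈⟨ ∘L-congˡ {B = R} (∘L-congʳ {A = T} L∘S≈I) ⟩
      R ∘L (idL rank ∘L T)   ≈⟨ ∘L-congˡ {B = R} (∘L-identityˡ T) ⟩
      R ∘L T                 ≈⟨ R∘T≈I ⟩
      idL d                  ∎
      where open import Relation.Binary.Reasoning.Setoid (Lin-setoid d d)

open GaussianElimination using (LeftCancellative; leftInverse; IdempotentSplitting; splitIdempotent)

module NuBasis (C : FinCat) where

  open FinCat C
  open ≡-Reasoning

  νencode : ∀ F Q → νIdx C F Q → Fin (νdim C F Q)
  νencode F Q (X , a , i) = unΣ⁻¹ nOb (λ X → Σℕ (nHom X Q) (λ _ → F X)) (X , unΣ⁻¹ (nHom X Q) (λ _ → F X) (a , i))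

  νdecode-νencode : ∀ F Q t → νdecode C F Q (νencode F Q t) ≡ t
  νdecode-νencode F Q (X , a , i)
    rewrite unΣ-unΣ⁻¹ nOb (λ X → Σℕ (nHom X Q) (λ _ → F X)) (X , unΣ⁻¹ (nHom X Q) (λ _ → F X) (a , i))
          | unΣ-unΣ⁻¹ (nHom X Q) (λ _ → F X) (a , i) = refl

  νencode-νdecode : ∀ F Q k → νencode F Q (νdecode C F Q k) ≡ k
  νencode-νdecode F Q k
    with unΣ nOb (λ X → Σℕ (nHom X Q) (λ _ → F X)) k | unΣ⁻¹-unΣ nOb (λ X → Σℕ (nHom X Q) (λ _ → F X)) k
  ... | X , k′ | outer with unΣ (nHom X Q) (λ _ → F X) k′ | unΣ⁻¹-unΣ (nHom X Q) (λ _ → F X) k′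
  ...   | a , i | inner = trans (cong (λ k″ → unΣ⁻¹ nOb _ (X , k″)) inner) outer

  νencode-injective : ∀ {F Q} {s t : νIdx C F Q} → νencode F Q s ≡ νencode F Q t → s ≡ t
  νencode-injective {F} {Q} {s} {t} eq =
    trans (sym (νdecode-νencode F Q s)) (trans (cong (νdecode C F Q) eq) (νdecode-νencode F Q t))

  νext : ∀ {F G Q Q′} {A B : Lin (νdim C F Q) (νdim C G Q′)} →
         (∀ s t → A (νencode G Q′ s) (νencode F Q t) ≡ B (νencode G Q′ s) (νencode F Q t)) → A ≈L B
  νext {F} {G} {Q} {Q′} {A} {B} A≈B r c = begin
    A r c                                               ≡⟨ cong₂ A (νencode-νdecode G Q′ r) (νencode-νdecode F Q c) ⟨
    A (νencode G Q′ (νdecode C G Q′ r)) (νencode F Q (νdecode C F Q c)) ≡⟨ A≈B _ _ ⟩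
    B (νencode G Q′ (νdecode C G Q′ r)) (νencode F Q (νdecode C F Q c)) ≡⟨ cong₂ B (νencode-νdecode G Q′ r) (νencode-νdecode F Q c) ⟩
    B r c                                               ∎

  νext-row : ∀ {F Q n} {A B : Lin n (νdim C F Q)} →
             (∀ s c → A (νencode F Q s) c ≡ B (νencode F Q s) c) → A ≈L B
  νext-row {F} {Q} {A = A} {B} A≈B r c = begin
    A r c                         ≡⟨ cong (λ r′ → A r′ c) (νencode-νdecode F Q r) ⟨
    A (νencode F Q (νdecode C F Q r)) c ≡⟨ A≈B _ c ⟩
    B (νencode F Q (νdecode C F Q r)) c ≡⟨ cong (λ r′ → B r′ c) (νencode-νdecode F Q r) ⟩
    B r c                         ∎

  Σν : ∀ F Q → (νIdx C F Q → ℚ) → ℚ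
  Σν F Q h = Σℚ nOb (λ X → Σℚ (nHom X Q) (λ a → Σℚ (F X) (λ i → h (X , a , i))))

  Σν-cong : ∀ F Q {h h′ : νIdx C F Q → ℚ} → (∀ t → h t ≡ h′ t) → Σν F Q h ≡ Σν F Q h′
  Σν-cong F Q h≗h′ = Σℚ-cong nOb (λ X → Σℚ-cong (nHom X Q) (λ a → Σℚ-cong (F X) (λ i → h≗h′ (X , a , i))))

  Σℚ-νdim : ∀ F Q (g : Fin (νdim C F Q) → ℚ) → Σℚ (νdim C F Q) g ≡ Σν F Q (g ∘ νencode F Q)
  Σℚ-νdim F Q g = trans (Σℚ-Σℕ nOb _ g) (Σℚ-cong nOb (λ X → Σℚ-Σℕ (nHom X Q) (λ _ → F X) _))

  ∘L-νdim : ∀ {F Q m n} (A : Lin (νdim C F Q) n) (B : Lin m (νdim C F Q)) k i →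
            (A ∘L B) k i ≡ Σν F Q (λ t → A k (νencode F Q t) * B (νencode F Q t) i)
  ∘L-νdim {F} {Q} A B k i = Σℚ-νdim F Q (λ j → A k j * B j i)

  Σν-at : ∀ F Q X (h : νIdx C F Q → ℚ) → (∀ t → X ≢ proj₁ t → h t ≡ 0ℚ) →
          Σν F Q h ≡ Σℚ (nHom X Q) (λ a → Σℚ (F X) (λ i → h (X , a , i)))
  Σν-at F Q X h h≡0 = Σℚ-single nOb X _ (λ Y X≢Y → Σℚ-zero (nHom Y Q) (λ b → Σℚ-zero (F Y) (λ j → h≡0 (Y , b , j) X≢Y)))

  Σν-single : ∀ F Q (s : νIdx C F Q) (h : νIdx C F Q → ℚ) → (∀ t → s ≢ t → h t ≡ 0ℚ) → Σν F Q h ≡ h s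
  Σν-single F Q (X , a , i) h h≡0 = begin
    Σν F Q h                                      ≡⟨ Σν-at F Q X h (λ t X≢Y → h≡0 t (X≢Y ∘ cong proj₁)) ⟩
    Σℚ (nHom X Q) (λ b → Σℚ (F X) (λ j → h (X , b , j)))
      ≡⟨ Σℚ-single (nHom X Q) a _ (λ b a≢b → Σℚ-zero (F X) (λ j → h≡0 (X , b , j) λ { refl → a≢b refl })) ⟩
    Σℚ (F X) (λ j → h (X , a , j))                 ≡⟨ Σℚ-single (F X) i _ (λ j i≢j → h≡0 (X , a , j) λ { refl → i≢j refl }) ⟩
    h (X , a , i)                                 ∎

  δν : ∀ {F Q} → νIdx C F Q → νIdx C F Q → ℚ
  δν (X , b , i) (X′ , a , i′) with X Fin.≟ X′
  ... | yes refl = δ b a * δ i i′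
  ... | no  _    = 0ℚ

  δν-same : ∀ {F Q} X (b a : Hom X Q) (i i′ : Fin (F X)) → δν {F} (X , b , i) (X , a , i′) ≡ δ b a * δ i i′
  δν-same X b a i i′ with X Fin.≟ X
  ... | yes refl = refl
  ... | no X≢X   = ⊥-elim (X≢X refl)

  δν-diff : ∀ {F Q} {X X′} (b : Hom X Q) (a : Hom X′ Q) i i′ → X ≢ X′ → δν {F} (X , b , i) (X′ , a , i′) ≡ 0ℚ
  δν-diff {X = X} {X′} b a i i′ X≢X′ with X Fin.≟ X′
  ... | yes X≡X′ = ⊥-elim (X≢X′ X≡X′)
  ... | no _     = refl

  δν-refl : ∀ {F Q} (t : νIdx C F Q) → δν t t ≡ 1ℚ
  δν-refl (X , a , i) = trans (δν-same X a a i i) (trans (cong₂ _*_ (δ-refl a) (δ-refl i)) (*-identityˡ 1ℚ))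

  δν-≢ : ∀ {F Q} (s t : νIdx C F Q) → s ≢ t → δν s t ≡ 0ℚ
  δν-≢ (X , b , i) (X′ , a , i′) s≢t with X Fin.≟ X′
  ... | no _     = refl
  ... | yes refl = δ*δ-≢ {b = b} {a} {i} {i′} λ { refl → s≢t refl }

  δ-νencode : ∀ {F Q} (s t : νIdx C F Q) → δ (νencode F Q s) (νencode F Q t) ≡ δν s t
  δ-νencode {F} {Q} s t with ≡-dec Fin._≟_ (≡-dec Fin._≟_ Fin._≟_) s t
  ... | yes refl = trans (δ-refl (νencode F Q s)) (sym (δν-refl s))
  ... | no s≢t   = trans (δ-≢ (s≢t ∘ νencode-injective)) (sym (δν-≢ s t s≢t))

  Σν-δˡ : ∀ F Q (s : νIdx C F Q) (h : νIdx C F Q → ℚ) → Σν F Q (λ t → δν s t * h t) ≡ h s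
  Σν-δˡ F Q s h = begin
    Σν F Q (λ t → δν s t * h t) ≡⟨ Σν-single F Q s _ (λ t s≢t → trans (cong (_* h t) (δν-≢ s t s≢t)) (*-zeroˡ (h t))) ⟩
    δν s s * h s                ≡⟨ cong (_* h s) (δν-refl s) ⟩
    1ℚ * h s                    ≡⟨ *-identityˡ (h s) ⟩
    h s                         ∎

  νpush : ∀ {F Q′ Q} → Hom Q′ Q → νIdx C F Q′ → νIdx C F Q
  νpush ψ (X , b , i) = X , comp ψ b , i

  νpush-id : ∀ {F Q} (t : νIdx C F Q) → νpush (idm Q) t ≡ t
  νpush-id (X , b , i) = cong (λ a → X , a , i) (idˡ b)

  νpush-comp : ∀ {F X Y Z} (g : Hom Y Z) (f : Hom X Y) (t : νIdx C F X) → νpush (comp g f) t ≡ νpush g (νpush f t)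
  νpush-comp g f (W , b , i) = cong (λ a → W , a , i) (assoc g f b)

  νactEntry≡δν : ∀ F {Q′ Q} (ψ : Hom Q′ Q) s t → νactEntry C F ψ s t ≡ δν (νpush ψ s) t
  νactEntry≡δν F ψ (X , b , i) (X′ , a , i′) with X Fin.≟ X′
  ... | yes refl = cong (_* δ i i′) (δ-sym a (comp ψ b))
  ... | no  _    = refl

  νact-νencode : ∀ F {Q′ Q} (ψ : Hom Q′ Q) s t →
                 act (νOb C F) ψ (νencode F Q′ s) (νencode F Q t) ≡ δν (νpush ψ s) t
  νact-νencode F {Q′} {Q} ψ s t =
    trans (cong₂ (νactEntry C F ψ) (νdecode-νencode F Q′ s) (νdecode-νencode F Q t)) (νactEntry≡δν F ψ s t)

  νact∘ : ∀ F {Q′ Q n} (ψ : Hom Q′ Q) (B : Lin n (νdim C F Q)) s i →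
          (act (νOb C F) ψ ∘L B) (νencode F Q′ s) i ≡ B (νencode F Q (νpush ψ s)) i
  νact∘ F {Q′} {Q} ψ B s i = begin
    (act (νOb C F) ψ ∘L B) (νencode F Q′ s) i
      ≡⟨ ∘L-νdim (act (νOb C F) ψ) B (νencode F Q′ s) i ⟩
    Σν F Q (λ t → act (νOb C F) ψ (νencode F Q′ s) (νencode F Q t) * B (νencode F Q t) i)
      ≡⟨ Σν-cong F Q (λ t → cong (_* B (νencode F Q t) i) (νact-νencode F ψ s t)) ⟩
    Σν F Q (λ t → δν (νpush ψ s) t * B (νencode F Q t) i)
      ≡⟨ Σν-δˡ F Q (νpush ψ s) (λ t → B (νencode F Q t) i) ⟩
    B (νencode F Q (νpush ψ s)) i ∎

  ∘νact : ∀ F {Q′ Q n} (ψ : Hom Q′ Q) (A : Lin (νdim C F Q′) n) k X (a : Hom X Q) i →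
          (A ∘L act (νOb C F) ψ) k (νencode F Q (X , a , i))
            ≡ Σℚ (nHom X Q′) (λ b → A k (νencode F Q′ (X , b , i)) * δ (comp ψ b) a)
  ∘νact F {Q′} {Q} ψ A k X a i = begin
    (A ∘L act (νOb C F) ψ) k (νencode F Q (X , a , i))
      ≡⟨ ∘L-νdim A (act (νOb C F) ψ) k _ ⟩
    Σν F Q′ (λ t → Aₖ t * act (νOb C F) ψ (νencode F Q′ t) (νencode F Q (X , a , i)))
      ≡⟨ Σν-cong F Q′ (λ t → cong (Aₖ t *_) (νact-νencode F ψ t (X , a , i))) ⟩
    Σν F Q′ (λ t → Aₖ t * δν (νpush ψ t) (X , a , i))
      ≡⟨ Σν-at F Q′ X _ (λ { (Y , b , j) X≢Y → off-X b j (X≢Y ∘ sym) }) ⟩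
    Σℚ (nHom X Q′) (λ b → Σℚ (F X) (λ j → Aₖ (X , b , j) * δν (X , comp ψ b , j) (X , a , i)))
      ≡⟨ Σℚ-cong (nHom X Q′) (λ b → trans (Σℚ-cong (F X) (at-X b)) (Σℚ-δʳ (F X) i (λ j → Aₖ (X , b , j) * δ (comp ψ b) a))) ⟩
    Σℚ (nHom X Q′) (λ b → Aₖ (X , b , i) * δ (comp ψ b) a) ∎
    where
    Aₖ : νIdx C F Q′ → ℚ
    Aₖ t = A k (νencode F Q′ t)
    off-X : ∀ {Y} (b : Hom Y Q′) j → Y ≢ X → Aₖ (Y , b , j) * δν (Y , comp ψ b , j) (X , a , i) ≡ 0ℚ
    off-X b j Y≢X = trans (cong (Aₖ (_ , b , j) *_) (δν-diff (comp ψ b) a j i Y≢X)) (*-zeroʳ (Aₖ (_ , b , j)))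
    at-X : ∀ b j → Aₖ (X , b , j) * δν (X , comp ψ b , j) (X , a , i) ≡ Aₖ (X , b , j) * δ (comp ψ b) a * δ j i
    at-X b j = trans (cong (Aₖ (X , b , j) *_) (δν-same X (comp ψ b) a j i)) (sym (*-assoc (Aₖ (X , b , j)) _ _))

  νMor-νencode : ∀ {F G Q} (α : SimpHom C F G) s t → νMor C α Q (νencode G Q s) (νencode F Q t) ≡ νMorEntry C α s t
  νMor-νencode {F} {G} {Q} α s t = cong₂ (νMorEntry C α) (νdecode-νencode G Q s) (νdecode-νencode F Q t)

module NuFunctor (C : FinCat) where

  open FinCat C
  open NuBasis C
  open ≡-Reasoning

  νOb-isPresheaf : ∀ F → IsPresheaf C (νOb C F)
  νOb-isPresheaf F = record { act-id = act-id ; act-comp = act-comp }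
    where
    act-id : ∀ Q → act (νOb C F) (idm Q) ≈L idL (νdim C F Q)
    act-id Q = νext {F} {F} λ s t → begin
      act (νOb C F) (idm Q) (νencode F Q s) (νencode F Q t) ≡⟨ νact-νencode F (idm Q) s t ⟩
      δν (νpush (idm Q) s) t                              ≡⟨ cong (λ u → δν u t) (νpush-id s) ⟩
      δν s t                                              ≡⟨ δ-νencode s t ⟨
      δ (νencode F Q s) (νencode F Q t)                   ∎
    act-comp : ∀ {X Y Z} (g : Hom Y Z) (f : Hom X Y) → act (νOb C F) (comp g f) ≈L (act (νOb C F) f ∘L act (νOb C F) g)
    act-comp {X} {Y} {Z} g f = νext {F} {F} λ s t → begin
      act (νOb C F) (comp g f) (νencode F X s) (νencode F Z t)      ≡⟨ νact-νencode F (comp g f) s t ⟩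
      δν (νpush (comp g f) s) t                                     ≡⟨ cong (λ u → δν u t) (νpush-comp g f s) ⟩
      δν (νpush g (νpush f s)) t                                    ≡⟨ νact-νencode F g (νpush f s) t ⟨
      act (νOb C F) g (νencode F Y (νpush f s)) (νencode F Z t)     ≡⟨ νact∘ F f (act (νOb C F) g) s (νencode F Z t) ⟨
      (act (νOb C F) f ∘L act (νOb C F) g) (νencode F X s) (νencode F Z t) ∎

  νMor-natural : ∀ F G (α : SimpHom C F G) → IsNatural C (νOb C F) (νOb C G) (νMor C α)
  νMor-natural F G α {Q′} {Q} ψ = νext {F} {G} λ { (Y , γ , j) (X , a , i) → begin
    (νMor C α Q′ ∘L act (νOb C F) ψ) (νencode G Q′ (Y , γ , j)) (νencode F Q (X , a , i))
      ≡⟨ ∘νact F ψ (νMor C α Q′) _ X a i ⟩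
    Σℚ (nHom X Q′) (λ b → νMor C α Q′ (νencode G Q′ (Y , γ , j)) (νencode F Q′ (X , b , i)) * δ (comp ψ b) a)
      ≡⟨ Σℚ-cong (nHom X Q′) (λ b → cong (_* δ (comp ψ b) a) (νMor-νencode α (Y , γ , j) (X , b , i))) ⟩
    Σℚ (nHom X Q′) (λ b → Σℚ (nHom X Y) (λ φ → δ (comp γ φ) b * α φ j i) * δ (comp ψ b) a)
      ≡⟨ pushforward Y γ j X a i ⟩
    Σℚ (nHom X Y) (λ φ → δ (comp (comp ψ γ) φ) a * α φ j i)
      ≡⟨ νMor-νencode α (Y , comp ψ γ , j) (X , a , i) ⟨
    νMor C α Q (νencode G Q (νpush ψ (Y , γ , j))) (νencode F Q (X , a , i))
      ≡⟨ νact∘ G ψ (νMor C α Q) (Y , γ , j) _ ⟨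
    (act (νOb C G) ψ ∘L νMor C α Q) (νencode G Q′ (Y , γ , j)) (νencode F Q (X , a , i)) ∎ }
    where
    pushforward : ∀ Y (γ : Hom Y Q′) j X (a : Hom X Q) i →
      Σℚ (nHom X Q′) (λ b → Σℚ (nHom X Y) (λ φ → δ (comp γ φ) b * α φ j i) * δ (comp ψ b) a)
      ≡ Σℚ (nHom X Y) (λ φ → δ (comp (comp ψ γ) φ) a * α φ j i)
    pushforward Y γ j X a i = begin
      Σℚ (nHom X Q′) (λ b → Σℚ (nHom X Y) (λ φ → δ (comp γ φ) b * α φ j i) * δ (comp ψ b) a)
        ≡⟨ Σℚ-cong (nHom X Q′) (λ b → trans (*-distribʳ-Σℚ (nHom X Y) (δ (comp ψ b) a) _)
              (Σℚ-cong (nHom X Y) (λ φ → *-assoc (δ (comp γ φ) b) (α φ j i) (δ (comp ψ b) a)))) ⟩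
      Σℚ (nHom X Q′) (λ b → Σℚ (nHom X Y) (λ φ → δ (comp γ φ) b * (α φ j i * δ (comp ψ b) a)))
        ≡⟨ Σℚ-comm (nHom X Q′) (nHom X Y) _ ⟩
      Σℚ (nHom X Y) (λ φ → Σℚ (nHom X Q′) (λ b → δ (comp γ φ) b * (α φ j i * δ (comp ψ b) a)))
        ≡⟨ Σℚ-cong (nHom X Y) (λ φ → trans (Σℚ-δˡ (nHom X Q′) (comp γ φ) (λ b → α φ j i * δ (comp ψ b) a))
              (trans (*-comm (α φ j i) _) (cong (λ c → δ c a * α φ j i) (sym (assoc ψ γ φ))))) ⟩
      Σℚ (nHom X Y) (λ φ → δ (comp (comp ψ γ) φ) a * α φ j i) ∎

  idS-same : ∀ F X (φ : Hom X X) k i → idS C F φ k i ≡ δ φ (idm X) * δ k i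
  idS-same F X φ k i with X Fin.≟ X
  ... | yes refl = refl
  ... | no X≢X   = ⊥-elim (X≢X refl)

  idS-diff : ∀ F {X Y} (φ : Hom X Y) k i → X ≢ Y → idS C F φ k i ≡ 0ℚ
  idS-diff F {X} {Y} φ k i X≢Y with X Fin.≟ Y
  ... | yes X≡Y = ⊥-elim (X≢Y X≡Y)
  ... | no _    = refl

  νMorEntry-idS : ∀ F {Q} (s t : νIdx C F Q) → νMorEntry C (idS C F) s t ≡ δν s t
  νMorEntry-idS F (Y , γ , j) (X , a , i) = from (X Fin.≟ Y)
    where
    from : Dec (X ≡ Y) → νMorEntry C (idS C F) (Y , γ , j) (X , a , i) ≡ δν (Y , γ , j) (X , a , i)
    from (no X≢Y) = begin
      Σℚ (nHom X Y) (λ φ → δ (comp γ φ) a * idS C F φ j i)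
        ≡⟨ Σℚ-zero (nHom X Y) (λ φ → trans (cong (δ (comp γ φ) a *_) (idS-diff F φ j i X≢Y)) (*-zeroʳ (δ (comp γ φ) a))) ⟩
      0ℚ
        ≡⟨ δν-diff γ a j i (X≢Y ∘ sym) ⟨
      δν (Y , γ , j) (X , a , i) ∎
    from (yes refl) = begin
      Σℚ (nHom X X) (λ φ → δ (comp γ φ) a * idS C F φ j i)
        ≡⟨ Σℚ-cong (nHom X X) (λ φ → trans (cong (δ (comp γ φ) a *_) (trans (idS-same F X φ j i) (*-comm (δ φ (idm X)) (δ j i))))
             (sym (*-assoc (δ (comp γ φ) a) (δ j i) (δ φ (idm X))))) ⟩
      Σℚ (nHom X X) (λ φ → δ (comp γ φ) a * δ j i * δ φ (idm X))
        ≡⟨ Σℚ-δʳ (nHom X X) (idm X) (λ φ → δ (comp γ φ) a * δ j i) ⟩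
      δ (comp γ (idm X)) a * δ j i
        ≡⟨ cong (λ c → δ c a * δ j i) (idʳ γ) ⟩
      δ γ a * δ j i
        ≡⟨ δν-same X γ a j i ⟨
      δν (X , γ , j) (X , a , i) ∎

  νMor-id : ∀ F → _≈C_ C {νOb C F} {νOb C F} (νMor C (idS C F)) (idC C (νOb C F))
  νMor-id F Q = νext {F} {F} λ s t →
    trans (νMor-νencode (idS C F) s t) (trans (νMorEntry-idS F s t) (sym (δ-νencode s t)))

  -- Both sides of ν(β ∘ α) ≈ ν β ∘ ν α reduce to a sum over pairs of
  -- composable morphisms X → Y → Z.
  module Composite {F G H : SimpOb C} (β : SimpHom C G H) (α : SimpHom C F G)
                   {Q} (Z : Ob) (γ : Hom Z Q) (k : Fin (H Z)) (X : Ob) (a : Hom X Q) (i : Fin (F X)) where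

    pairSum : ℚ
    pairSum = Σℚ nOb (λ Y → Σℚ (nHom X Y) (λ φ₁ → Σℚ (nHom Y Z) (λ φ₂ → δ (comp γ (comp φ₂ φ₁)) a * (β φ₂ ∘L α φ₁) k i)))

    *-swapˡ : ∀ x y z → x * (y * z) ≡ y * (x * z)
    *-swapˡ x y z = trans (sym (*-assoc x y z)) (trans (cong (_* z) (*-comm x y)) (*-assoc y x z))

    νMorEntry-∘S : νMorEntry C (_∘S_ C {F} {G} {H} β α) (Z , γ , k) (X , a , i) ≡ pairSum
    νMorEntry-∘S = begin
      Σℚ (nHom X Z) (λ φ → δ (comp γ φ) a * Σℚ nOb (λ Y → Σℚ (nHom X Y) (λ φ₁ → Σℚ (nHom Y Z) (λ φ₂ → δ (comp φ₂ φ₁) φ * T φ₁ φ₂))))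
        ≡⟨ Σℚ-cong (nHom X Z) (λ φ → trans (*-distribˡ-Σℚ nOb (δ (comp γ φ) a) _) (Σℚ-cong nOb (λ Y → trans (*-distribˡ-Σℚ (nHom X Y) (δ (comp γ φ) a) _)
             (Σℚ-cong (nHom X Y) (λ φ₁ → *-distribˡ-Σℚ (nHom Y Z) (δ (comp γ φ) a) (λ φ₂ → δ (comp φ₂ φ₁) φ * T φ₁ φ₂)))))) ⟩
      Σℚ (nHom X Z) (λ φ → Σℚ nOb (λ Y → Σℚ (nHom X Y) (λ φ₁ → Σℚ (nHom Y Z) (λ φ₂ → δ (comp γ φ) a * (δ (comp φ₂ φ₁) φ * T φ₁ φ₂)))))
        ≡⟨ Σℚ-comm (nHom X Z) nOb _ ⟩
      Σℚ nOb (λ Y → Σℚ (nHom X Z) (λ φ → Σℚ (nHom X Y) (λ φ₁ → Σℚ (nHom Y Z) (λ φ₂ → δ (comp γ φ) a * (δ (comp φ₂ φ₁) φ * T φ₁ φ₂)))))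
        ≡⟨ Σℚ-cong nOb (λ Y → trans (Σℚ-comm (nHom X Z) (nHom X Y) _) (Σℚ-cong (nHom X Y) (λ φ₁ → Σℚ-comm (nHom X Z) (nHom Y Z) _))) ⟩
      Σℚ nOb (λ Y → Σℚ (nHom X Y) (λ φ₁ → Σℚ (nHom Y Z) (λ φ₂ → Σℚ (nHom X Z) (λ φ → δ (comp γ φ) a * (δ (comp φ₂ φ₁) φ * T φ₁ φ₂)))))
        ≡⟨ Σℚ-cong nOb (λ Y → Σℚ-cong (nHom X Y) (λ φ₁ → Σℚ-cong (nHom Y Z) (λ φ₂ →
             trans (Σℚ-cong (nHom X Z) (λ φ → *-swapˡ (δ (comp γ φ) a) (δ (comp φ₂ φ₁) φ) (T φ₁ φ₂)))
                   (Σℚ-δˡ (nHom X Z) (comp φ₂ φ₁) (λ φ → δ (comp γ φ) a * T φ₁ φ₂))))) ⟩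
      pairSum ∎
      where
      T : ∀ {Y} → Hom X Y → Hom Y Z → ℚ
      T φ₁ φ₂ = (β φ₂ ∘L α φ₁) k i

    Σν-νMorEntry : Σν G Q (λ t → νMorEntry C β (Z , γ , k) t * νMorEntry C α t (X , a , i)) ≡ pairSum
    Σν-νMorEntry = Σℚ-cong nOb through
      where
      through : ∀ Y → Σℚ (nHom Y Q) (λ b → Σℚ (G Y) (λ j → νMorEntry C β (Z , γ , k) (Y , b , j) * νMorEntry C α (Y , b , j) (X , a , i)))
                    ≡ Σℚ (nHom X Y) (λ φ₁ → Σℚ (nHom Y Z) (λ φ₂ → δ (comp γ (comp φ₂ φ₁)) a * (β φ₂ ∘L α φ₁) k i))
      through Y = begin
        Σℚ (nHom Y Q) (λ b → Σℚ (G Y) (λ j → Σℚ (nHom Y Z) (λ φ₂ → δ (comp γ φ₂) b * β φ₂ k j) * A b j))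
          ≡⟨ Σℚ-cong (nHom Y Q) (λ b → Σℚ-cong (G Y) (λ j → trans (*-distribʳ-Σℚ (nHom Y Z) (A b j) _)
                (Σℚ-cong (nHom Y Z) (λ φ₂ → *-assoc (δ (comp γ φ₂) b) (β φ₂ k j) (A b j))))) ⟩
        Σℚ (nHom Y Q) (λ b → Σℚ (G Y) (λ j → Σℚ (nHom Y Z) (λ φ₂ → δ (comp γ φ₂) b * (β φ₂ k j * A b j))))
          ≡⟨ Σℚ-comm (nHom Y Q) (G Y) _ ⟩
        Σℚ (G Y) (λ j → Σℚ (nHom Y Q) (λ b → Σℚ (nHom Y Z) (λ φ₂ → δ (comp γ φ₂) b * (β φ₂ k j * A b j))))
          ≡⟨ Σℚ-cong (G Y) (λ j → trans (Σℚ-comm (nHom Y Q) (nHom Y Z) _)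
                (Σℚ-cong (nHom Y Z) (λ φ₂ → Σℚ-δˡ (nHom Y Q) (comp γ φ₂) (λ b → β φ₂ k j * A b j)))) ⟩
        Σℚ (G Y) (λ j → Σℚ (nHom Y Z) (λ φ₂ → β φ₂ k j * A (comp γ φ₂) j))
          ≡⟨ Σℚ-cong (G Y) (λ j → Σℚ-cong (nHom Y Z) (λ φ₂ → trans (*-distribˡ-Σℚ (nHom X Y) (β φ₂ k j) _)
                (Σℚ-cong (nHom X Y) (λ φ₁ → trans (*-swapˡ (β φ₂ k j) (δ (comp (comp γ φ₂) φ₁) a) (α φ₁ j i))
                    (cong (λ c → δ c a * (β φ₂ k j * α φ₁ j i)) (assoc γ φ₂ φ₁)))))) ⟩
        Σℚ (G Y) (λ j → Σℚ (nHom Y Z) (λ φ₂ → Σℚ (nHom X Y) (λ φ₁ → δ (comp γ (comp φ₂ φ₁)) a * (β φ₂ k j * α φ₁ j i))))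
          ≡⟨ Σℚ-comm (G Y) (nHom Y Z) _ ⟩
        Σℚ (nHom Y Z) (λ φ₂ → Σℚ (G Y) (λ j → Σℚ (nHom X Y) (λ φ₁ → δ (comp γ (comp φ₂ φ₁)) a * (β φ₂ k j * α φ₁ j i))))
          ≡⟨ Σℚ-cong (nHom Y Z) (λ φ₂ → Σℚ-comm (G Y) (nHom X Y) _) ⟩
        Σℚ (nHom Y Z) (λ φ₂ → Σℚ (nHom X Y) (λ φ₁ → Σℚ (G Y) (λ j → δ (comp γ (comp φ₂ φ₁)) a * (β φ₂ k j * α φ₁ j i))))
          ≡⟨ Σℚ-comm (nHom Y Z) (nHom X Y) _ ⟩
        Σℚ (nHom X Y) (λ φ₁ → Σℚ (nHom Y Z) (λ φ₂ → Σℚ (G Y) (λ j → δ (comp γ (comp φ₂ φ₁)) a * (β φ₂ k j * α φ₁ j i))))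
          ≡⟨ Σℚ-cong (nHom X Y) (λ φ₁ → Σℚ-cong (nHom Y Z) (λ φ₂ → sym (*-distribˡ-Σℚ (G Y) (δ (comp γ (comp φ₂ φ₁)) a) _))) ⟩
        Σℚ (nHom X Y) (λ φ₁ → Σℚ (nHom Y Z) (λ φ₂ → δ (comp γ (comp φ₂ φ₁)) a * (β φ₂ ∘L α φ₁) k i)) ∎
        where
        A : Hom Y Q → Fin (G Y) → ℚ
        A b j = Σℚ (nHom X Y) (λ φ₁ → δ (comp b φ₁) a * α φ₁ j i)

  νMor-∘ : ∀ F G H (β : SimpHom C G H) (α : SimpHom C F G)
           → _≈C_ C {νOb C F} {νOb C H} (νMor C (_∘S_ C {F} {G} {H} β α))
               (_∘C_ C {νOb C F} {νOb C G} {νOb C H} (νMor C β) (νMor C α))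
  νMor-∘ F G H β α Q = νext {F} {H} λ { s@(Z , γ , k) u@(X , a , i) → begin
    νMor C (_∘S_ C {F} {G} {H} β α) Q (νencode H Q s) (νencode F Q u)
      ≡⟨ νMor-νencode (_∘S_ C {F} {G} {H} β α) s u ⟩
    νMorEntry C (_∘S_ C {F} {G} {H} β α) s u
      ≡⟨ Composite.νMorEntry-∘S β α Z γ k X a i ⟩
    Composite.pairSum β α Z γ k X a i
      ≡⟨ Composite.Σν-νMorEntry β α Z γ k X a i ⟨
    Σν G Q (λ t → νMorEntry C β s t * νMorEntry C α t u)
      ≡⟨ Σν-cong G Q (λ t → cong₂ _*_ (νMor-νencode β s t) (νMor-νencode α t u)) ⟨
    Σν G Q (λ t → νMor C β Q (νencode H Q s) (νencode G Q t) * νMor C α Q (νencode G Q t) (νencode F Q u))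
      ≡⟨ ∘L-νdim (νMor C β Q) (νMor C α Q) _ _ ⟨
    (νMor C β Q ∘L νMor C α Q) (νencode H Q s) (νencode F Q u) ∎ }

  νMor-at-identity : ∀ {F G} (α : SimpHom C F G) {X Y} (φ : Hom X Y) j i →
                     νMor C α Y (νencode G Y (Y , idm Y , j)) (νencode F Y (X , φ , i)) ≡ α φ j i
  νMor-at-identity {F} {G} α {X} {Y} φ j i = begin
    νMor C α Y (νencode G Y (Y , idm Y , j)) (νencode F Y (X , φ , i))
      ≡⟨ νMor-νencode α (Y , idm Y , j) (X , φ , i) ⟩
    Σℚ (nHom X Y) (λ φ′ → δ (comp (idm Y) φ′) φ * α φ′ j i)
      ≡⟨ Σℚ-cong (nHom X Y) (λ φ′ → cong (_* α φ′ j i) (trans (cong (λ c → δ c φ) (idˡ φ′)) (δ-sym φ′ φ))) ⟩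
    Σℚ (nHom X Y) (λ φ′ → δ φ φ′ * α φ′ j i)
      ≡⟨ Σℚ-δˡ (nHom X Y) φ (λ φ′ → α φ′ j i) ⟩
    α φ j i ∎

  νMor-faithful : ∀ F G (α β : SimpHom C F G) → _≈C_ C {νOb C F} {νOb C G} (νMor C α) (νMor C β) → _≈S_ C {F} {G} α β
  νMor-faithful F G α β να≈νβ {X} {Y} φ j i =
    trans (sym (νMor-at-identity α φ j i)) (trans (να≈νβ Y _ _) (νMor-at-identity β φ j i))

  νMor-full : ∀ F G (η : Components C (νOb C F) (νOb C G)) → IsNatural C (νOb C F) (νOb C G) η →
              Σ (SimpHom C F G) (λ α → _≈C_ C {νOb C F} {νOb C G} (νMor C α) η)
  νMor-full F G η natural = α , λ Q → νext {F} {G} λ { (Y , γ , j) (X , a , i) → begin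
    νMor C α Q (νencode G Q (Y , γ , j)) (νencode F Q (X , a , i))
      ≡⟨ νMor-νencode α (Y , γ , j) (X , a , i) ⟩
    Σℚ (nHom X Y) (λ φ → δ (comp γ φ) a * η Y (unit Y j) (νencode F Y (X , φ , i)))
      ≡⟨ Σℚ-cong (nHom X Y) (λ φ → *-comm (δ (comp γ φ) a) _) ⟩
    Σℚ (nHom X Y) (λ φ → η Y (unit Y j) (νencode F Y (X , φ , i)) * δ (comp γ φ) a)
      ≡⟨ ∘νact F γ (η Y) (unit Y j) X a i ⟨
    (η Y ∘L act (νOb C F) γ) (unit Y j) (νencode F Q (X , a , i))
      ≡⟨ natural γ (unit Y j) (νencode F Q (X , a , i)) ⟩
    (act (νOb C G) γ ∘L η Q) (unit Y j) (νencode F Q (X , a , i))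
      ≡⟨ νact∘ G γ (η Q) (Y , idm Y , j) _ ⟩
    η Q (νencode G Q (Y , comp γ (idm Y) , j)) (νencode F Q (X , a , i))
      ≡⟨ cong (λ c → η Q (νencode G Q (Y , c , j)) (νencode F Q (X , a , i))) (idʳ γ) ⟩
    η Q (νencode G Q (Y , γ , j)) (νencode F Q (X , a , i)) ∎ }
    where
    unit : ∀ Y → Fin (G Y) → Fin (νdim C G Y)
    unit Y j = νencode G Y (Y , idm Y , j)
    α : SimpHom C F G
    α {X} {Y} φ j i = η Y (unit Y j) (νencode F Y (X , φ , i))

-- The presheaf Hom(-, X) ⊗ ℚᵏ, freely generated by k vectors at X.
module FreePresheaf (C : FinCat) (X : FinCat.Ob C) (k : ℕ) where

  open FinCat C
  open ≡-Reasoning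

  freeDim : Ob → ℕ
  freeDim Q = Σℕ (nHom Q X) (λ _ → k)

  basis : ∀ Q → Fin (freeDim Q) → Hom Q X × Fin k
  basis Q = unΣ (nHom Q X) (λ _ → k)

  generator : Fin k → Fin (freeDim X)
  generator i = unΣ⁻¹ (nHom X X) (λ _ → k) (idm X , i)

  freeEntry : ∀ {Q′ Q} → Hom Q′ Q → Hom Q′ X × Fin k → Hom Q X × Fin k → ℚ
  freeEntry ψ (b′ , i′) (b , i) = δ b′ (comp b ψ) * δ i′ i

  Free : RawPresheaf C
  dim Free = freeDim
  act Free {Q′} {Q} ψ r c = freeEntry ψ (basis Q′ r) (basis Q c)

  Σ-freeEntry : ∀ {Q′ Q} (ψ : Hom Q′ Q) (m : Hom Q′ X × Fin k → ℚ) (b : Hom Q X) (i : Fin k) →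
                Σℚ (freeDim Q′) (λ c → m (basis Q′ c) * freeEntry ψ (basis Q′ c) (b , i)) ≡ m (comp b ψ , i)
  Σ-freeEntry {Q′} ψ m b i = begin
    Σℚ (freeDim Q′) (λ c → m (basis Q′ c) * freeEntry ψ (basis Q′ c) (b , i))
      ≡⟨ Σℚ-unΣ (nHom Q′ X) (λ _ → k) (λ p → m p * freeEntry ψ p (b , i)) ⟩
    Σℚ (nHom Q′ X) (λ b′ → Σℚ k (λ i′ → m (b′ , i′) * (δ b′ (comp b ψ) * δ i′ i)))
      ≡⟨ Σℚ-cong (nHom Q′ X) (λ b′ → trans (Σℚ-cong k (λ i′ → sym (*-assoc (m (b′ , i′)) _ _)))
                                           (Σℚ-δʳ k i (λ i′ → m (b′ , i′) * δ b′ (comp b ψ)))) ⟩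
    Σℚ (nHom Q′ X) (λ b′ → m (b′ , i) * δ b′ (comp b ψ))
      ≡⟨ Σℚ-δʳ (nHom Q′ X) (comp b ψ) (λ b′ → m (b′ , i)) ⟩
    m (comp b ψ , i) ∎

  Free-isPresheaf : IsPresheaf C Free
  Free-isPresheaf = record { act-id = act-id ; act-comp = act-comp }
    where
    act-id : ∀ Q → act Free (idm Q) ≈L idL (freeDim Q)
    act-id Q r c = trans (cong (λ b → δ (proj₁ (basis Q r)) b * δ (proj₂ (basis Q r)) (proj₂ (basis Q c))) (idʳ (proj₁ (basis Q c))))
                         (sym (δ-unΣ (nHom Q X) k r c))
    act-comp : ∀ {Q₁ Q₂ Q₃} (g : Hom Q₂ Q₃) (f : Hom Q₁ Q₂) → act Free (comp g f) ≈L (act Free f ∘L act Free g)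
    act-comp {Q₁} {Q₂} {Q₃} g f r c = sym (begin
      Σℚ (freeDim Q₂) (λ j → freeEntry f (basis Q₁ r) (basis Q₂ j) * freeEntry g (basis Q₂ j) (basis Q₃ c))
        ≡⟨ Σ-freeEntry g (freeEntry f (basis Q₁ r)) b₃ i₃ ⟩
      δ (proj₁ (basis Q₁ r)) (comp (comp b₃ g) f) * δ (proj₂ (basis Q₁ r)) i₃
        ≡⟨ cong (λ b → δ (proj₁ (basis Q₁ r)) b * δ (proj₂ (basis Q₁ r)) i₃) (assoc b₃ g f) ⟩
      freeEntry (comp g f) (basis Q₁ r) (basis Q₃ c) ∎)
      where
      b₃ : Hom Q₃ X
      b₃ = proj₁ (basis Q₃ c)
      i₃ : Fin k
      i₃ = proj₂ (basis Q₃ c)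

module Monos (C : FinCat) where

  open FinCat C
  open FreePresheaf C using (Free; Free-isPresheaf; basis; generator; freeEntry; freeDim; Σ-freeEntry)
  open ≡-Reasoning

  fromGenerators : ∀ (A : RawPresheaf C) {X k} → Lin k (dim A X) → Components C (Free X k) A
  fromGenerators A {X} {k} N Q p c = (act A (proj₁ (basis X k Q c)) ∘L N) p (proj₂ (basis X k Q c))

  module _ {A : RawPresheaf C} (isA : IsPresheaf C A) {X k} (N : Lin k (dim A X)) where
    open IsPresheaf isA

    fromGenerators-natural : IsNatural C (Free X k) A (fromGenerators A N)
    fromGenerators-natural {Q′} {Q} ψ p c = begin
      Σℚ (freeDim X k Q′) (λ c′ → fromGenerators A N Q′ p c′ * freeEntry X k ψ (basis X k Q′ c′) (b , i))
        ≡⟨ Σ-freeEntry X k ψ (λ (b′ , i′) → (act A b′ ∘L N) p i′) b i ⟩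
      (act A (comp b ψ) ∘L N) p i
        ≡⟨ ∘L-congʳ {A = N} (act-comp b ψ) p i ⟩
      ((act A ψ ∘L act A b) ∘L N) p i
        ≡⟨ ∘L-assoc (act A ψ) (act A b) N p i ⟩
      (act A ψ ∘L fromGenerators A N Q) p c ∎
      where
      b : Hom Q X
      b = proj₁ (basis X k Q c)
      i : Fin k
      i = proj₂ (basis X k Q c)

    fromGenerators-generator : ∀ p i → fromGenerators A N X p (generator X k i) ≡ N p i
    fromGenerators-generator p i = begin
      fromGenerators A N X p (generator X k i) ≡⟨ cong (λ (b , i′) → (act A b ∘L N) p i′) (unΣ-unΣ⁻¹ (nHom X X) (λ _ → k) (idm X , i)) ⟩
      (act A (idm X) ∘L N) p i               ≡⟨ ∘L-congʳ {A = N} (act-id X) p i ⟩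
      (idL (dim A X) ∘L N) p i               ≡⟨ ∘L-identityˡ N p i ⟩
      N p i                                  ∎

  ∘-fromGenerators : ∀ {A B : RawPresheaf C} {m : Components C A B} → IsNatural C A B m →
                     ∀ {X k} (N : Lin k (dim A X)) Q → (m Q ∘L fromGenerators A N Q) ≈L fromGenerators B (m X ∘L N) Q
  ∘-fromGenerators {A} {B} {m} natural {X} {k} N Q p c = begin
    (m Q ∘L (act A b ∘L N)) p i        ≡⟨ ∘L-assoc (m Q) (act A b) N p i ⟨
    ((m Q ∘L act A b) ∘L N) p i        ≡⟨ ∘L-congʳ {A = N} (natural b) p i ⟩
    ((act B b ∘L m X) ∘L N) p i        ≡⟨ ∘L-assoc (act B b) (m X) N p i ⟩
    (act B b ∘L (m X ∘L N)) p i        ∎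
    where
    b : Hom Q X
    b = proj₁ (basis X k Q c)
    i : Fin k
    i = proj₂ (basis X k Q c)

  mono⇒leftCancellative : ∀ A B (m : NatTrans C (proj₁ A) (proj₁ B)) → Mono C A B m → ∀ X → LeftCancellative (proj₁ m X)
  mono⇒leftCancellative (A , isA) (B , isB) (m , natural) mono X {k} N N′ m∘N≈m∘N′ p i = begin
    N p i                                       ≡⟨ fromGenerators-generator isA N p i ⟨
    fromGenerators A N X p (generator X k i)    ≡⟨ N-generators≈N′-generators X p (generator X k i) ⟩
    fromGenerators A N′ X p (generator X k i)   ≡⟨ fromGenerators-generator isA N′ p i ⟩
    N′ p i                                      ∎
    where
    N-generators≈N′-generators : _≈C_ C {Free X k} {A} (fromGenerators A N) (fromGenerators A N′)
    N-generators≈N′-generators =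
      mono (Free X k , Free-isPresheaf X k) (fromGenerators A N) (fromGenerators A N′)
           (fromGenerators-natural isA N) (fromGenerators-natural isA N′)
           λ Q → ≈L-trans (∘-fromGenerators {A} {B} {m} natural N Q)
                 (≈L-trans (λ p c → ∘L-congˡ {B = act B (proj₁ (basis X k Q c))} m∘N≈m∘N′ p (proj₂ (basis X k Q c)))
                           (≈L-sym (∘-fromGenerators {A} {B} {m} natural N′ Q)))

module Coinduction (C : FinCat) where

  open FinCat C
  open NuBasis C
  open ≡-Reasoning

  coinduceEntry : ∀ F (B : RawPresheaf C) → (∀ X → Lin (dim B X) (F X)) → ∀ {Q} → νIdx C F Q → Fin (dim B Q) → ℚ
  coinduceEntry F B ĝ (X , a , i) c = (ĝ X ∘L act B a) i c

  coinduce : ∀ F (B : RawPresheaf C) → (∀ X → Lin (dim B X) (F X)) → Components C B (νOb C F)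
  coinduce F B ĝ Q r = coinduceEntry F B ĝ (νdecode C F Q r)

  coinduce-νencode : ∀ F B ĝ {Q} (t : νIdx C F Q) c → coinduce F B ĝ Q (νencode F Q t) c ≡ coinduceEntry F B ĝ t c
  coinduce-νencode F B ĝ {Q} t c = cong (λ t′ → coinduceEntry F B ĝ t′ c) (νdecode-νencode F Q t)

  coinduce-natural : ∀ F {B} → IsPresheaf C B → (ĝ : ∀ X → Lin (dim B X) (F X)) → IsNatural C B (νOb C F) (coinduce F B ĝ)
  coinduce-natural F {B} isB ĝ {Q′} {Q} ψ = νext-row λ { (X , a , i) c → begin
    Σℚ (dim B Q′) (λ j → coinduce F B ĝ Q′ (νencode F Q′ (X , a , i)) j * act B ψ j c)
      ≡⟨ Σℚ-cong (dim B Q′) (λ j → cong (_* act B ψ j c) (coinduce-νencode F B ĝ (X , a , i) j)) ⟩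
    ((ĝ X ∘L act B a) ∘L act B ψ) i c
      ≡⟨ ∘L-assoc (ĝ X) (act B a) (act B ψ) i c ⟩
    (ĝ X ∘L (act B a ∘L act B ψ)) i c
      ≡⟨ ∘L-congˡ {B = ĝ X} (IsPresheaf.act-comp isB ψ a) i c ⟨
    coinduceEntry F B ĝ (X , comp ψ a , i) c
      ≡⟨ coinduce-νencode F B ĝ (X , comp ψ a , i) c ⟨
    coinduce F B ĝ Q (νencode F Q (νpush ψ (X , a , i))) c
      ≡⟨ νact∘ F ψ (coinduce F B ĝ Q) (X , a , i) c ⟨
    (act (νOb C F) ψ ∘L coinduce F B ĝ Q) (νencode F Q′ (X , a , i)) c ∎ }

  diagonalOf : ∀ F (A : RawPresheaf C) → Components C A (νOb C F) → ∀ X → Lin (dim A X) (F X)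
  diagonalOf F A f X i c = f X (νencode F X (X , idm X , i)) c

  coinduce-diagonalOf : ∀ F A (f : Components C A (νOb C F)) → IsNatural C A (νOb C F) f →
                        _≈C_ C {A} {νOb C F} f (coinduce F A (diagonalOf F A f))
  coinduce-diagonalOf F A f natural Q = νext-row λ { (X , a , i) c → begin
    f Q (νencode F Q (X , a , i)) c
      ≡⟨ cong (λ b → f Q (νencode F Q (X , b , i)) c) (idʳ a) ⟨
    f Q (νencode F Q (νpush a (X , idm X , i))) c
      ≡⟨ νact∘ F a (f Q) (X , idm X , i) c ⟨
    (act (νOb C F) a ∘L f Q) (νencode F X (X , idm X , i)) c
      ≡⟨ natural a (νencode F X (X , idm X , i)) c ⟨
    (diagonalOf F A f X ∘L act A a) i c
      ≡⟨ coinduce-νencode F A (diagonalOf F A f) (X , a , i) c ⟨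
    coinduce F A (diagonalOf F A f) Q (νencode F Q (X , a , i)) c ∎ }

  -- A map f : A → ν F is determined by its diagonal part, and extending
  -- along a mono m only needs a left inverse of each component m X.
  νOb-injective : ∀ F → Injective C (νOb C F , NuFunctor.νOb-isPresheaf C F)
  νOb-injective F (A , isA) (B , isB) (m , m-natural) mono f f-natural =
    coinduce F B ĝ , coinduce-natural F isB ĝ , g∘m≈f
    where
    K : ∀ X → Lin (dim B X) (dim A X)
    K X = proj₁ (leftInverse (m X) (Monos.mono⇒leftCancellative C (A , isA) (B , isB) (m , m-natural) mono X))
    K∘m≈I : ∀ X → (K X ∘L m X) ≈L idL (dim A X)
    K∘m≈I X = proj₂ (leftInverse (m X) (Monos.mono⇒leftCancellative C (A , isA) (B , isB) (m , m-natural) mono X))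
    ĝ : ∀ X → Lin (dim B X) (F X)
    ĝ X = diagonalOf F A f X ∘L K X
    K∘m∘act≈act : ∀ {X Q} (a : Hom X Q) → (K X ∘L (m X ∘L act A a)) ≈L act A a
    K∘m∘act≈act {X} a = ≈L-trans (≈L-sym (∘L-assoc (K X) (m X) (act A a)))
                        (≈L-trans (∘L-congʳ {A = act A a} (K∘m≈I X)) (∘L-identityˡ (act A a)))
    g∘m≈f : _≈C_ C {A} {νOb C F} (_∘C_ C {A} {B} {νOb C F} (coinduce F B ĝ) m) f
    g∘m≈f Q = νext-row λ { (X , a , i) c → begin
      Σℚ (dim B Q) (λ j → coinduce F B ĝ Q (νencode F Q (X , a , i)) j * m Q j c)
        ≡⟨ Σℚ-cong (dim B Q) (λ j → cong (_* m Q j c) (coinduce-νencode F B ĝ (X , a , i) j)) ⟩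
      ((ĝ X ∘L act B a) ∘L m Q) i c
        ≡⟨ ∘L-assoc (ĝ X) (act B a) (m Q) i c ⟩
      (ĝ X ∘L (act B a ∘L m Q)) i c
        ≡⟨ ∘L-congˡ {B = ĝ X} (m-natural a) i c ⟨
      ((diagonalOf F A f X ∘L K X) ∘L (m X ∘L act A a)) i c
        ≡⟨ ∘L-assoc (diagonalOf F A f X) (K X) (m X ∘L act A a) i c ⟩
      (diagonalOf F A f X ∘L (K X ∘L (m X ∘L act A a))) i c
        ≡⟨ ∘L-congˡ {B = diagonalOf F A f X} (K∘m∘act≈act a) i c ⟩
      (diagonalOf F A f X ∘L act A a) i c
        ≡⟨ coinduce-νencode F A (diagonalOf F A f) (X , a , i) c ⟨
      coinduce F A (diagonalOf F A f) Q (νencode F Q (X , a , i)) c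
        ≡⟨ coinduce-diagonalOf F A f f-natural Q _ c ⟨
      f Q (νencode F Q (X , a , i)) c ∎ }

module PresheafCategory (C : FinCat) where

  PSh : Category
  PSh = record
    { Obj = RawPresheaf C
    ; _⇒_ = NatTrans C
    ; _≈_ = λ {P} {R} η θ → _≈C_ C {P} {R} (proj₁ η) (proj₁ θ)
    ; id = λ {P} → idC C P , λ f → ≈L-trans (∘L-identityˡ (act P f)) (≈L-sym (∘L-identityʳ (act P f)))
    ; _∘_ = λ {P} {R} {S} θ η → _∘C_ C {P} {R} {S} (proj₁ θ) (proj₁ η) , ∘-natural {P} {R} {S} (proj₁ θ) (proj₁ η) (proj₂ θ) (proj₂ η)
    ; ≈-isEquivalence = record
      { refl = λ _ _ _ → refl ; sym = λ η≈θ X k i → sym (η≈θ X k i) ; trans = λ η≈θ θ≈ι X k i → trans (η≈θ X k i) (θ≈ι X k i) }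
    ; ∘-cong = λ θ≈θ′ η≈η′ X → ∘L-cong (θ≈θ′ X) (η≈η′ X)
    ; assoc = λ ι θ η X → ∘L-assoc (proj₁ ι X) (proj₁ θ X) (proj₁ η X)
    ; identityˡ = λ η X → ∘L-identityˡ (proj₁ η X)
    ; identityʳ = λ η X → ∘L-identityʳ (proj₁ η X)
    }
    where
    ∘-natural : ∀ {P R S} (θ : Components C R S) (η : Components C P R) →
                IsNatural C R S θ → IsNatural C P R η → IsNatural C P S (_∘C_ C {P} {R} {S} θ η)
    ∘-natural {P} {R} {S} θ η θ-natural η-natural {X} {Y} f = begin
      (θ X ∘L η X) ∘L act P f   ≈⟨ ∘L-assoc (θ X) (η X) (act P f) ⟩
      θ X ∘L (η X ∘L act P f)   ≈⟨ ∘L-congˡ {B = θ X} (η-natural f) ⟩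
      θ X ∘L (act R f ∘L η Y)   ≈⟨ ∘L-assoc (θ X) (act R f) (η Y) ⟨
      (θ X ∘L act R f) ∘L η Y   ≈⟨ ∘L-congʳ {A = η Y} (θ-natural f) ⟩
      (act S f ∘L θ Y) ∘L η Y   ≈⟨ ∘L-assoc (act S f) (θ Y) (η Y) ⟩
      act S f ∘L (θ Y ∘L η Y)   ∎
      where open import Relation.Binary.Reasoning.Setoid (Lin-setoid (dim P Y) (dim S X))

module SimpCategory (C : FinCat) where

  open FinCat C
  open NuFunctor C
  open PresheafCategory C

  ∘S-cong : ∀ {F G H} {β β′ : SimpHom C G H} {α α′ : SimpHom C F G} → _≈S_ C {G} {H} β β′ → _≈S_ C {F} {G} α α′ →
            _≈S_ C {F} {H} (_∘S_ C {F} {G} {H} β α) (_∘S_ C {F} {G} {H} β′ α′)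
  ∘S-cong β≈β′ α≈α′ {X} {Z} φ k i =
    Σℚ-cong nOb (λ Y → Σℚ-cong (nHom X Y) (λ φ₁ → Σℚ-cong (nHom Y Z) (λ φ₂ →
      cong (δ (comp φ₂ φ₁) φ *_) (∘L-cong (β≈β′ φ₂) (α≈α′ φ₁) k i))))

  νMor-cong : ∀ {F G} {α β : SimpHom C F G} → _≈S_ C {F} {G} α β → _≈C_ C {νOb C F} {νOb C G} (νMor C α) (νMor C β)
  νMor-cong {F} {G} {α} {β} α≈β Q r c = entry (νdecode C G Q r) (νdecode C F Q c)
    where
    entry : ∀ s t → νMorEntry C α {Q} s t ≡ νMorEntry C β s t
    entry (Y , γ , j) (X , a , i) = Σℚ-cong (nHom X Y) (λ φ → cong (δ (comp γ φ) a *_) (α≈β φ j i))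

  -- The category laws of Simp(C,V) are reflected from matrices along ν,
  -- which is faithful and preserves composition and identities.
  ∘S-assoc : ∀ {F G H K} (γ : SimpHom C H K) (β : SimpHom C G H) (α : SimpHom C F G) →
             _≈S_ C {F} {K} (_∘S_ C {F} {G} {K} (_∘S_ C {G} {H} {K} γ β) α) (_∘S_ C {F} {H} {K} γ (_∘S_ C {F} {G} {H} β α))
  ∘S-assoc {F} {G} {H} {K} γ β α = νMor-faithful F K ((γ · β) · α) (γ · (β · α)) ν-assoc
    where
    infixr 9 _·_
    _·_ : ∀ {F G H} → SimpHom C G H → SimpHom C F G → SimpHom C F H
    _·_ {F} {G} {H} = _∘S_ C {F} {G} {H}
    ν-assoc : ∀ Q → νMor C ((γ · β) · α) Q ≈L νMor C (γ · (β · α)) Q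
    ν-assoc Q = begin
      νMor C ((γ · β) · α) Q                       ≈⟨ νMor-∘ F G K (γ · β) α Q ⟩
      νMor C (γ · β) Q ∘L νMor C α Q               ≈⟨ ∘L-congʳ {A = νMor C α Q} (νMor-∘ G H K γ β Q) ⟩
      (νMor C γ Q ∘L νMor C β Q) ∘L νMor C α Q     ≈⟨ ∘L-assoc (νMor C γ Q) (νMor C β Q) (νMor C α Q) ⟩
      νMor C γ Q ∘L (νMor C β Q ∘L νMor C α Q)     ≈⟨ ∘L-congˡ {B = νMor C γ Q} (νMor-∘ F G H β α Q) ⟨
      νMor C γ Q ∘L νMor C (β · α) Q               ≈⟨ νMor-∘ F H K γ (β · α) Q ⟨
      νMor C (γ · (β · α)) Q                       ∎
      where open import Relation.Binary.Reasoning.Setoid (Lin-setoid (νdim C F Q) (νdim C K Q))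

  ∘S-identityˡ : ∀ {F G} (α : SimpHom C F G) → _≈S_ C {F} {G} (_∘S_ C {F} {G} {G} (idS C G) α) α
  ∘S-identityˡ {F} {G} α = νMor-faithful F G (_∘S_ C {F} {G} {G} (idS C G) α) α λ Q →
    ≈L-trans (νMor-∘ F G G (idS C G) α Q) (≈L-trans (∘L-congʳ {A = νMor C α Q} (νMor-id G Q)) (∘L-identityˡ (νMor C α Q)))

  ∘S-identityʳ : ∀ {F G} (α : SimpHom C F G) → _≈S_ C {F} {G} (_∘S_ C {F} {F} {G} α (idS C F)) α
  ∘S-identityʳ {F} {G} α = νMor-faithful F G (_∘S_ C {F} {F} {G} α (idS C F)) α λ Q →
    ≈L-trans (νMor-∘ F F G α (idS C F) Q) (≈L-trans (∘L-congˡ {B = νMor C α Q} (νMor-id F Q)) (∘L-identityʳ (νMor C α Q)))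

  Simp : Category
  Simp = record
    { Obj = SimpOb C
    ; _⇒_ = SimpHom C
    ; _≈_ = λ {F} {G} → _≈S_ C {F} {G}
    ; id = λ {F} → idS C F
    ; _∘_ = λ {F} {G} {H} → _∘S_ C {F} {G} {H}
    ; ≈-isEquivalence = λ {F} {G} → record
      { refl = λ _ _ _ → refl
      ; sym = λ α≈β φ k i → sym (α≈β φ k i)
      ; trans = λ {α} {β} {γ} α≈β β≈γ φ k i → trans (α≈β φ k i) (β≈γ φ k i) }
    ; ∘-cong = λ {F} {G} {H} → ∘S-cong {F} {G} {H}
    ; assoc = λ {F} {G} {H} {K} → ∘S-assoc {F} {G} {H} {K}
    ; identityˡ = λ {F} {G} → ∘S-identityˡ {F} {G}
    ; identityʳ = λ {F} {G} → ∘S-identityʳ {F} {G}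
    }

  ν : Functor Simp PSh
  ν = record
    { F₀ = νOb C
    ; F₁ = λ {F} {G} α → νMor C α , νMor-natural F G α
    ; F-resp-≈ = λ {F} {G} → νMor-cong {F} {G}
    ; identity = λ {F} → νMor-id F
    ; homomorphism = λ {F} {G} {H} → νMor-∘ F G H
    }

module EndomorphismRing (C : FinCat) where

  open FinCat C
  open NuFunctor C
  open SimpCategory C

  infixl 6 _+S_
  _+S_ : ∀ {F G} → SimpHom C F G → SimpHom C F G → SimpHom C F G
  (α +S β) φ = α φ +L β φ

  -S_ : ∀ {F G} → SimpHom C F G → SimpHom C F G
  (-S α) φ k i = - α φ k i

  0S : ∀ {F G} → SimpHom C F G
  0S φ = zeroL

  νMor-+ : ∀ {F G} (α β : SimpHom C F G) Q → νMor C (α +S β) Q ≈L (νMor C α Q +L νMor C β Q)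
  νMor-+ {F} {G} α β Q r c = entry (νdecode C G Q r) (νdecode C F Q c)
    where
    entry : ∀ s t → νMorEntry C (α +S β) {Q} s t ≡ νMorEntry C α s t + νMorEntry C β s t
    entry (Y , γ , j) (X , a , i) =
      trans (Σℚ-cong (nHom X Y) (λ φ → *-distribˡ-+ (δ (comp γ φ) a) (α φ j i) (β φ j i))) (Σℚ-distrib-+ (nHom X Y) _ _)

  module _ {F G H : SimpOb C} where
    private
      infixr 9 _·_
      _·_ : ∀ {F G H} → SimpHom C G H → SimpHom C F G → SimpHom C F H
      _·_ {F} {G} {H} = _∘S_ C {F} {G} {H}

    ∘S-distribˡ : ∀ (γ : SimpHom C G H) (α β : SimpHom C F G) → _≈S_ C {F} {H} (γ · (α +S β)) ((γ · α) +S (γ · β))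
    ∘S-distribˡ γ α β = νMor-faithful F H (γ · (α +S β)) ((γ · α) +S (γ · β)) ν-distrib
      where
      ν-distrib : ∀ Q → νMor C (γ · (α +S β)) Q ≈L νMor C ((γ · α) +S (γ · β)) Q
      ν-distrib Q = begin
        νMor C (γ · (α +S β)) Q                              ≈⟨ νMor-∘ F G H γ (α +S β) Q ⟩
        νMor C γ Q ∘L νMor C (α +S β) Q                      ≈⟨ ∘L-congˡ {B = νMor C γ Q} (νMor-+ α β Q) ⟩
        νMor C γ Q ∘L (νMor C α Q +L νMor C β Q)             ≈⟨ ∘L-distribˡ (νMor C γ Q) (νMor C α Q) (νMor C β Q) ⟩
        (νMor C γ Q ∘L νMor C α Q) +L (νMor C γ Q ∘L νMor C β Q)
          ≈⟨ (λ k i → cong₂ _+_ (νMor-∘ F G H γ α Q k i) (νMor-∘ F G H γ β Q k i)) ⟨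
        νMor C (γ · α) Q +L νMor C (γ · β) Q                 ≈⟨ νMor-+ (γ · α) (γ · β) Q ⟨
        νMor C ((γ · α) +S (γ · β)) Q                        ∎
        where open import Relation.Binary.Reasoning.Setoid (Lin-setoid (νdim C F Q) (νdim C H Q))

    ∘S-distribʳ : ∀ (γ : SimpHom C F G) (α β : SimpHom C G H) → _≈S_ C {F} {H} ((α +S β) · γ) ((α · γ) +S (β · γ))
    ∘S-distribʳ γ α β = νMor-faithful F H ((α +S β) · γ) ((α · γ) +S (β · γ)) ν-distrib
      where
      ν-distrib : ∀ Q → νMor C ((α +S β) · γ) Q ≈L νMor C ((α · γ) +S (β · γ)) Q
      ν-distrib Q = begin
        νMor C ((α +S β) · γ) Q                              ≈⟨ νMor-∘ F G H (α +S β) γ Q ⟩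
        νMor C (α +S β) Q ∘L νMor C γ Q                      ≈⟨ ∘L-congʳ {A = νMor C γ Q} (νMor-+ α β Q) ⟩
        (νMor C α Q +L νMor C β Q) ∘L νMor C γ Q             ≈⟨ ∘L-distribʳ (νMor C γ Q) (νMor C α Q) (νMor C β Q) ⟩
        (νMor C α Q ∘L νMor C γ Q) +L (νMor C β Q ∘L νMor C γ Q)
          ≈⟨ (λ k i → cong₂ _+_ (νMor-∘ F G H α γ Q k i) (νMor-∘ F G H β γ Q k i)) ⟨
        νMor C (α · γ) Q +L νMor C (β · γ) Q                 ≈⟨ νMor-+ (α · γ) (β · γ) Q ⟨
        νMor C ((α · γ) +S (β · γ)) Q                        ∎
        where open import Relation.Binary.Reasoning.Setoid (Lin-setoid (νdim C F Q) (νdim C H Q))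

  End : SimpOb C → Ring 0ℓ 0ℓ
  End G = record
    { Carrier = SimpHom C G G
    ; _≈_ = _≈S_ C {G} {G}
    ; _+_ = _+S_ {G} {G}
    ; _*_ = _∘S_ C {G} {G} {G}
    ; -_ = -S_ {G} {G}
    ; 0# = 0S {G} {G}
    ; 1# = idS C G
    ; isRing = record
      { +-isAbelianGroup = +-isAbelianGroup
      ; *-cong = ∘S-cong {G} {G} {G}
      ; *-assoc = ∘S-assoc {G} {G} {G} {G}
      ; *-identity = ∘S-identityˡ {G} {G} , ∘S-identityʳ {G} {G}
      ; distrib = ∘S-distribˡ {G} {G} {G} , ∘S-distribʳ {G} {G} {G}
      }
    }
    where
    +-isAbelianGroup : IsAbelianGroup (_≈S_ C {G} {G}) (_+S_ {G} {G}) (0S {G} {G}) (-S_ {G} {G})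
    +-isAbelianGroup = record
      { isGroup = record
        { isMonoid = record
          { isSemigroup = record
            { isMagma = record
              { isEquivalence = Category.≈-isEquivalence Simp
              ; ∙-cong = λ α≈α′ β≈β′ φ k i → cong₂ _+_ (α≈α′ φ k i) (β≈β′ φ k i)
              }
            ; assoc = λ α β γ φ k i → +-assoc (α φ k i) (β φ k i) (γ φ k i)
            }
          ; identity = (λ α φ k i → +-identityˡ (α φ k i)) , (λ α φ k i → +-identityʳ (α φ k i))
          }
        ; inverse = (λ α φ k i → +-inverseˡ (α φ k i)) , (λ α φ k i → +-inverseʳ (α φ k i))
        ; ⁻¹-cong = λ α≈β φ k i → cong -_ (α≈β φ k i)
        }
      ; comm = λ α β φ k i → +-comm (α φ k i) (β φ k i)
      }

module Counting where

  count : ∀ {n} {P : Pred (Fin n) 0ℓ} → Decidable P → ℕ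
  count {zero}  P? = 0
  count {suc n} P? with P? zero
  ... | yes _ = suc (count (P? ∘ suc))
  ... | no  _ = count (P? ∘ suc)

  count≤n : ∀ {n} {P : Pred (Fin n) 0ℓ} (P? : Decidable P) → count P? ≤ n
  count≤n {zero}  P? = z≤n
  count≤n {suc n} P? with P? zero
  ... | yes _ = s≤s (count≤n (P? ∘ suc))
  ... | no  _ = ℕₚ.m≤n⇒m≤1+n (count≤n (P? ∘ suc))

  count-mono : ∀ {n} {P Q : Pred (Fin n) 0ℓ} (P? : Decidable P) (Q? : Decidable Q) →
               (∀ x → P x → Q x) → count P? ≤ count Q?
  count-mono {zero}  P? Q? P⊆Q = z≤n
  count-mono {suc n} P? Q? P⊆Q with P? zero | Q? zero
  ... | yes _  | yes _  = s≤s (count-mono (P? ∘ suc) (Q? ∘ suc) (P⊆Q ∘ suc))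
  ... | yes p₀ | no ¬q₀ = ⊥-elim (¬q₀ (P⊆Q zero p₀))
  ... | no _   | yes _  = ℕₚ.m≤n⇒m≤1+n (count-mono (P? ∘ suc) (Q? ∘ suc) (P⊆Q ∘ suc))
  ... | no _   | no _   = count-mono (P? ∘ suc) (Q? ∘ suc) (P⊆Q ∘ suc)

  count-strict : ∀ {n} {P Q : Pred (Fin n) 0ℓ} (P? : Decidable P) (Q? : Decidable Q) →
                 (∀ x → P x → Q x) → ∀ y → Q y → ¬ P y → count P? < count Q?
  count-strict {suc n} P? Q? P⊆Q zero qy ¬py with P? zero | Q? zero
  ... | yes p₀ | _      = ⊥-elim (¬py p₀)
  ... | no _   | no ¬q₀ = ⊥-elim (¬q₀ qy)
  ... | no _   | yes _  = s≤s (count-mono (P? ∘ suc) (Q? ∘ suc) (P⊆Q ∘ suc))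
  count-strict {suc n} P? Q? P⊆Q (suc y) qy ¬py with P? zero | Q? zero
  ... | yes _  | yes _  = s≤s (count-strict (P? ∘ suc) (Q? ∘ suc) (P⊆Q ∘ suc) y qy ¬py)
  ... | yes p₀ | no ¬q₀ = ⊥-elim (¬q₀ (P⊆Q zero p₀))
  ... | no _   | yes _  = ℕₚ.m≤n⇒m≤1+n (count-strict (P? ∘ suc) (Q? ∘ suc) (P⊆Q ∘ suc) y qy ¬py)
  ... | no _   | no _   = count-strict (P? ∘ suc) (Q? ∘ suc) (P⊆Q ∘ suc) y qy ¬py

module Heights (C : FinCat) where

  open FinCat C
  open Counting

  inhabited? : ∀ n → Dec (Fin n)
  inhabited? zero    = no λ ()
  inhabited? (suc n) = yes zero

  _≺_ : Ob → Ob → Set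
  Z ≺ Y = Hom Z Y × ¬ Hom Y Z

  _≺?_ : ∀ Z Y → Dec (Z ≺ Y)
  Z ≺? Y = inhabited? (nHom Z Y) ×-dec ¬? (inhabited? (nHom Y Z))

  height : Ob → ℕ
  height Y = count (_≺? Y)

  height≤nOb : ∀ Y → height Y ≤ nOb
  height≤nOb Y = count≤n (_≺? Y)

  height-< : ∀ {X Y} → Hom X Y → ¬ Hom Y X → height X < height Y
  height-< {X} {Y} φ ¬ψ = count-strict (_≺? X) (_≺? Y) below-X⇒below-Y X (φ , ¬ψ) (λ (_ , ¬id) → ¬id (idm X))
    where
    below-X⇒below-Y : ∀ Z → Z ≺ X → Z ≺ Y
    below-X⇒below-Y Z (f , ¬g) = comp φ f , λ g → ¬g (comp g φ)

module SimpIdempotents (C : FinCat) (semitopological : Semitopological C) where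

  open FinCat C
  open NuFunctor C using (idS-same; idS-diff)
  open SimpCategory C using (Simp)
  open EndomorphismRing C using (End)
  open Heights C
  open ≡-Reasoning

  Σℚ-endo : ∀ X (f : Hom X X → ℚ) → Σℚ (nHom X X) f ≡ f (idm X)
  Σℚ-endo X f = Σℚ-single (nHom X X) (idm X) f (λ φ id≢φ → ⊥-elim (id≢φ (sym (semitopological X φ))))

  diagonalAt : ∀ {F G : SimpOb C} → (∀ X → Lin (F X) (G X)) → ∀ {X Y} → Dec (X ≡ Y) → Lin (F X) (G Y)
  diagonalAt A {X} (yes refl) = A X
  diagonalAt A     (no _)     = zeroL

  diagonal : ∀ {F G : SimpOb C} → (∀ X → Lin (F X) (G X)) → SimpHom C F G
  diagonal A {X} {Y} _ = diagonalAt A (X Fin.≟ Y)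

  module _ {F G : SimpOb C} where

    diagonal-same : ∀ (A : ∀ X → Lin (F X) (G X)) X (φ : Hom X X) → diagonal A φ ≈L A X
    diagonal-same A X φ with X Fin.≟ X
    ... | yes refl = ≈L-refl
    ... | no X≢X   = ⊥-elim (X≢X refl)

    diagonal-diff : ∀ (A : ∀ X → Lin (F X) (G X)) {X Y} (φ : Hom X Y) → X ≢ Y → diagonal A φ ≈L zeroL
    diagonal-diff A {X} {Y} φ X≢Y with X Fin.≟ Y
    ... | yes X≡Y = ⊥-elim (X≢Y X≡Y)
    ... | no _    = ≈L-refl

    ≈S-by-cases : ∀ {α β : SimpHom C F G} →
                  (∀ X (φ : Hom X X) → α φ ≈L β φ) → (∀ {X Y} (φ : Hom X Y) → X ≢ Y → α φ ≈L β φ) → _≈S_ C {F} {G} α β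
    ≈S-by-cases {α} {β} same diff {X} {Y} φ = from (X Fin.≟ Y) φ
      where
      from : ∀ {X Y} → Dec (X ≡ Y) → (φ : Hom X Y) → α φ ≈L β φ
      from {X} (yes refl) φ = same X φ
      from     (no X≢Y)   φ = diff φ X≢Y

    diagonal-cong : ∀ {A B : ∀ X → Lin (F X) (G X)} → (∀ X → A X ≈L B X) → _≈S_ C {F} {G} (diagonal A) (diagonal B)
    diagonal-cong {A} {B} A≈B = ≈S-by-cases
      (λ X φ → ≈L-trans (diagonal-same A X φ) (≈L-trans (A≈B X) (≈L-sym (diagonal-same B X φ))))
      (λ φ X≢Y → ≈L-trans (diagonal-diff A φ X≢Y) (≈L-sym (diagonal-diff B φ X≢Y)))

  idS≈diagonal : ∀ F → _≈S_ C {F} {F} (idS C F) (diagonal (λ X → idL (F X)))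
  idS≈diagonal F = ≈S-by-cases
    (λ X φ k i → begin
      idS C F φ k i             ≡⟨ idS-same F X φ k i ⟩
      δ φ (idm X) * δ k i       ≡⟨ cong (λ ψ → δ ψ (idm X) * δ k i) (semitopological X φ) ⟩
      δ (idm X) (idm X) * δ k i ≡⟨ cong (_* δ k i) (δ-refl (idm X)) ⟩
      1ℚ * δ k i                ≡⟨ *-identityˡ (δ k i) ⟩
      δ k i                     ≡⟨ diagonal-same (λ X → idL (F X)) X φ k i ⟨
      diagonal (λ X → idL (F X)) φ k i ∎)
    (λ φ X≢Y k i → trans (idS-diff F φ k i X≢Y) (sym (diagonal-diff (λ X → idL (F X)) φ X≢Y k i)))

  ∘S-diagonalʳ : ∀ {F G H : SimpOb C} (β : SimpHom C G H) (B : ∀ X → Lin (F X) (G X)) {X Z} (φ : Hom X Z) →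
                 _∘S_ C {F} {G} {H} β (diagonal B) φ ≈L (β φ ∘L B X)
  ∘S-diagonalʳ {F} {G} {H} β B {X} {Z} φ k i = begin
    Σℚ nOb (λ Y → Σℚ (nHom X Y) (λ φ₁ → Σℚ (nHom Y Z) (λ φ₂ → δ (comp φ₂ φ₁) φ * (β φ₂ ∘L diagonal B φ₁) k i)))
      ≡⟨ Σℚ-single nOb X _ (λ Y X≢Y → Σℚ-zero (nHom X Y) (λ φ₁ → Σℚ-zero (nHom Y Z) (λ φ₂ → through-zero Y X≢Y φ₁ φ₂))) ⟩
    Σℚ (nHom X X) (λ φ₁ → Σℚ (nHom X Z) (λ φ₂ → δ (comp φ₂ φ₁) φ * (β φ₂ ∘L diagonal B φ₁) k i))
      ≡⟨ Σℚ-endo X _ ⟩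
    Σℚ (nHom X Z) (λ φ₂ → δ (comp φ₂ (idm X)) φ * (β φ₂ ∘L diagonal B (idm X)) k i)
      ≡⟨ Σℚ-cong (nHom X Z) (λ φ₂ → cong₂ _*_ (trans (cong (λ ψ → δ ψ φ) (idʳ φ₂)) (δ-sym φ₂ φ))
                                                 (∘L-congˡ {B = β φ₂} (diagonal-same B X (idm X)) k i)) ⟩
    Σℚ (nHom X Z) (λ φ₂ → δ φ φ₂ * (β φ₂ ∘L B X) k i)
      ≡⟨ Σℚ-δˡ (nHom X Z) φ (λ φ₂ → (β φ₂ ∘L B X) k i) ⟩
    (β φ ∘L B X) k i ∎
    where
    through-zero : ∀ Y → X ≢ Y → (φ₁ : Hom X Y) (φ₂ : Hom Y Z) → δ (comp φ₂ φ₁) φ * (β φ₂ ∘L diagonal B φ₁) k i ≡ 0ℚ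
    through-zero Y X≢Y φ₁ φ₂ = begin
      δ (comp φ₂ φ₁) φ * (β φ₂ ∘L diagonal B φ₁) k i ≡⟨ cong (δ (comp φ₂ φ₁) φ *_) (∘L-congˡ {B = β φ₂} (diagonal-diff B φ₁ X≢Y) k i) ⟩
      δ (comp φ₂ φ₁) φ * (β φ₂ ∘L zeroL) k i         ≡⟨ cong (δ (comp φ₂ φ₁) φ *_) (∘L-zeroʳ (β φ₂) k i) ⟩
      δ (comp φ₂ φ₁) φ * 0ℚ                          ≡⟨ *-zeroʳ (δ (comp φ₂ φ₁) φ) ⟩
      0ℚ                                             ∎

  diagonal-∘ : ∀ {F G H : SimpOb C} (A : ∀ X → Lin (G X) (H X)) (B : ∀ X → Lin (F X) (G X)) →
               _≈S_ C {F} {H} (_∘S_ C {F} {G} {H} (diagonal A) (diagonal B)) (diagonal (λ X → A X ∘L B X))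
  diagonal-∘ A B = ≈S-by-cases
    (λ X φ → ≈L-trans (∘S-diagonalʳ (diagonal A) B φ)
             (≈L-trans (∘L-congʳ {A = B X} (diagonal-same A X φ)) (≈L-sym (diagonal-same (λ X → A X ∘L B X) X φ))))
    (λ {X} φ X≢Y → ≈L-trans (∘S-diagonalʳ (diagonal A) B φ)
             (≈L-trans (∘L-congʳ {A = B X} (diagonal-diff A φ X≢Y))
             (≈L-trans (∘L-zeroˡ (B X)) (≈L-sym (diagonal-diff (λ X → A X ∘L B X) φ X≢Y)))))

  diagonal-splitting : ∀ {G : SimpOb C} (E : ∀ X → Lin (G X) (G X)) → (∀ X → (E X ∘L E X) ≈L E X) →
                       Category.Splitting Simp (diagonal E)
  diagonal-splitting {G} E idempotent = record
    { Image = λ X → rank X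
    ; s = diagonal S
    ; t = diagonal T
    ; t∘s≈id = ≈S-trans (diagonal-∘ T S) (≈S-trans (diagonal-cong T∘S≈I) (≈S-sym (idS≈diagonal rank)))
    ; s∘t≈e = ≈S-trans (diagonal-∘ S T) (diagonal-cong S∘T≈E)
    }
    where
    open Category Simp using () renaming (≈-trans to ≈S-trans; ≈-sym to ≈S-sym)
    open module PointwiseSplitting X = IdempotentSplitting (splitIdempotent (E X) (idempotent X))

  diagonalPart : ∀ {G} → SimpHom C G G → SimpHom C G G
  diagonalPart α = diagonal (λ X → α (idm X))

  SkeletalSupport : SimpOb C → Set
  SkeletalSupport G = ∀ {X Y} → Hom X Y → Hom Y X → X ≢ Y → G X ≡ 0 ⊎ G Y ≡ 0

  Lin-trivial : ∀ {d e} → d ≡ 0 ⊎ e ≡ 0 → (A B : Lin d e) → A ≈L B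
  Lin-trivial (inj₁ refl) A B k ()
  Lin-trivial (inj₂ refl) A B ()

  ∘S-at-identity : ∀ {G} → SkeletalSupport G → ∀ (β α : SimpHom C G G) X →
                   _∘S_ C {G} {G} {G} β α (idm X) ≈L (β (idm X) ∘L α (idm X))
  ∘S-at-identity {G} skeletal β α X k i = begin
    Σℚ nOb (λ Y → Σℚ (nHom X Y) (λ φ₁ → Σℚ (nHom Y X) (λ φ₂ → δ (comp φ₂ φ₁) (idm X) * (β φ₂ ∘L α φ₁) k i)))
      ≡⟨ Σℚ-single nOb X _ (λ Y X≢Y → Σℚ-zero (nHom X Y) (λ φ₁ → Σℚ-zero (nHom Y X) (λ φ₂ →
           trans (cong (δ (comp φ₂ φ₁) (idm X) *_) (through-isomorphic X≢Y φ₁ φ₂)) (*-zeroʳ (δ (comp φ₂ φ₁) (idm X)))))) ⟩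
    Σℚ (nHom X X) (λ φ₁ → Σℚ (nHom X X) (λ φ₂ → δ (comp φ₂ φ₁) (idm X) * (β φ₂ ∘L α φ₁) k i))
      ≡⟨ trans (Σℚ-endo X _) (Σℚ-endo X _) ⟩
    δ (comp (idm X) (idm X)) (idm X) * (β (idm X) ∘L α (idm X)) k i
      ≡⟨ cong (λ ψ → δ ψ (idm X) * (β (idm X) ∘L α (idm X)) k i) (idˡ (idm X)) ⟩
    δ (idm X) (idm X) * (β (idm X) ∘L α (idm X)) k i
      ≡⟨ trans (cong (_* (β (idm X) ∘L α (idm X)) k i) (δ-refl (idm X))) (*-identityˡ _) ⟩
    (β (idm X) ∘L α (idm X)) k i ∎
    where
    through-isomorphic : ∀ {Y} → X ≢ Y → (φ₁ : Hom X Y) (φ₂ : Hom Y X) → (β φ₂ ∘L α φ₁) k i ≡ 0ℚ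
    through-isomorphic X≢Y φ₁ φ₂ with skeletal φ₁ φ₂ X≢Y
    ... | inj₁ GX≡0 = Lin-trivial (inj₁ GX≡0) (β φ₂ ∘L α φ₁) zeroL k i
    ... | inj₂ GY≡0 = trans (∘L-congˡ {B = β φ₂} (Lin-trivial (inj₂ GY≡0) (α φ₁) zeroL) k i) (∘L-zeroʳ (β φ₂) k i)

  module _ {G : SimpOb C} where
    private module E = Ring (End G)

    diagonalPart-* : SkeletalSupport G → ∀ (β α : SimpHom C G G) → diagonalPart (β E.* α) E.≈ diagonalPart β E.* diagonalPart α
    diagonalPart-* skeletal β α =
      E.trans (diagonal-cong (∘S-at-identity skeletal β α)) (E.sym (diagonal-∘ (λ X → β (idm X)) (λ X → α (idm X))))

    diagonalPart-1# : diagonalPart E.1# E.≈ E.1#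
    diagonalPart-1# = E.trans (diagonal-cong id-at-identity) (E.sym (idS≈diagonal G))
      where
      id-at-identity : ∀ X → idS C G (idm X) ≈L idL (G X)
      id-at-identity X k i = trans (idS-same G X (idm X) k i) (trans (cong (_* δ k i) (δ-refl (idm X))) (*-identityˡ (δ k i)))

    diagonalPart-+ : ∀ (α β : SimpHom C G G) → diagonalPart (α E.+ β) E.≈ diagonalPart α E.+ diagonalPart β
    diagonalPart-+ α β = ≈S-by-cases
      (λ X φ k i → trans (diagonal-same _ X φ k i) (sym (cong₂ _+_ (diagonal-same _ X φ k i) (diagonal-same _ X φ k i))))
      (λ φ X≢Y k i → trans (diagonal-diff _ φ X≢Y k i)
                     (sym (trans (cong₂ _+_ (diagonal-diff _ φ X≢Y k i) (diagonal-diff _ φ X≢Y k i)) (+-identityˡ 0ℚ))))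

    diagonalPart-neg : ∀ (α : SimpHom C G G) → diagonalPart (E.- α) E.≈ E.- diagonalPart α
    diagonalPart-neg α = ≈S-by-cases
      (λ X φ k i → trans (diagonal-same _ X φ k i) (sym (cong -_ (diagonal-same _ X φ k i))))
      (λ φ X≢Y k i → trans (diagonal-diff _ φ X≢Y k i) (sym (cong -_ (diagonal-diff _ φ X≢Y k i))))

    diagonalPart-cong : ∀ {α β : SimpHom C G G} → α E.≈ β → diagonalPart α E.≈ diagonalPart β
    diagonalPart-cong α≈β = diagonal-cong (λ X → α≈β (idm X))

    diagonalPart-idempotent : ∀ (α : SimpHom C G G) → diagonalPart (diagonalPart α) E.≈ diagonalPart α
    diagonalPart-idempotent α = diagonal-cong (λ X → diagonal-same (λ X → α (idm X)) X (idm X))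

    HeightRaising : ℕ → SimpHom C G G → Set
    HeightRaising j α = ∀ {X Y} (φ : Hom X Y) → height Y < height X ℕ.+ j → α φ ≈L zeroL

    HeightRaising-1# : HeightRaising 0 E.1#
    HeightRaising-1# {X} {Y} φ lt = from (X Fin.≟ Y)
      where
      from : Dec (X ≡ Y) → idS C G φ ≈L zeroL
      from (yes refl) = ⊥-elim (ℕₚ.<-irrefl (sym (ℕₚ.+-identityʳ (height X))) lt)
      from (no X≢Y)   = λ k i → idS-diff G φ k i X≢Y

    HeightRaising-* : ∀ {a b} {α β : SimpHom C G G} → HeightRaising a α → HeightRaising b β → HeightRaising (a ℕ.+ b) (β E.* α)
    HeightRaising-* {a} {b} {α} {β} α-raising β-raising {X} {Y} φ lt k i =
      Σℚ-zero nOb (λ W → Σℚ-zero (nHom X W) (λ φ₁ → Σℚ-zero (nHom W Y) (λ φ₂ →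
        trans (cong (δ (comp φ₂ φ₁) φ *_) (through W φ₁ φ₂)) (*-zeroʳ (δ (comp φ₂ φ₁) φ)))))
      where
      through : ∀ W (φ₁ : Hom X W) (φ₂ : Hom W Y) → (β φ₂ ∘L α φ₁) k i ≡ 0ℚ
      through W φ₁ φ₂ with height W ℕ.<? height X ℕ.+ a
      ... | yes low = trans (∘L-congˡ {B = β φ₂} (α-raising φ₁ low) k i) (∘L-zeroʳ (β φ₂) k i)
      ... | no ¬low = trans (∘L-congʳ {A = α φ₁} (β-raising φ₂ high) k i) (∘L-zeroˡ (α φ₁) k i)
        where
        high : height Y < height W ℕ.+ b
        high = ℕₚ.<-≤-trans (subst (height Y <_) (sym (ℕₚ.+-assoc (height X) a b)) lt) (ℕₚ.+-monoˡ-≤ b (ℕₚ.≮⇒≥ ¬low))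

    HeightRaising-top : ∀ {α : SimpHom C G G} → HeightRaising (suc nOb) α → α E.≈ E.0#
    HeightRaising-top α-raising {X} {Y} φ =
      α-raising φ (ℕₚ.<-≤-trans (s≤s (height≤nOb Y)) (ℕₚ.m≤n+m (suc nOb) (height X)))

    -- Between distinct isomorphic objects α vanishes by skeletal support;
    -- along the other morphisms X → Y the height increases.
    diagonalPart≈0⇒HeightRaising : SkeletalSupport G → ∀ {α : SimpHom C G G} → diagonalPart α E.≈ E.0# → HeightRaising 1 α
    diagonalPart≈0⇒HeightRaising skeletal {α} πα≈0 {X} {Y} φ lt = from (X Fin.≟ Y)
      where
      from : Dec (X ≡ Y) → α φ ≈L zeroL
      from (yes refl) = ≈L-trans (λ k i → cong (λ ψ → α ψ k i) (semitopological X φ))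
                        (≈L-trans (≈L-sym (diagonal-same (λ X → α (idm X)) X (idm X))) (πα≈0 (idm X)))
      from (no X≢Y) with inhabited? (nHom Y X)
      ... | yes ψ = Lin-trivial (skeletal φ ψ X≢Y) (α φ) zeroL
      ... | no ¬ψ = ⊥-elim (ℕₚ.<⇒≱ (height-< φ ¬ψ) (ℕₚ.≤-pred (subst (height Y <_) (ℕₚ.+-comm (height X) 1) lt)))

  module _ {G : SimpOb C} (skeletal : SkeletalSupport G) where
    private module E = Ring (End G)
    open import Algebra.Definitions.RawSemiring (Semiring.rawSemiring E.semiring) using (_^_)

    diagonalPart-kernel-nilpotent : ∀ (x : E.Carrier) → diagonalPart x E.≈ E.0# → x ^ suc nOb E.≈ E.0#
    diagonalPart-kernel-nilpotent x πx≈0 = HeightRaising-top (powers-raise (suc nOb))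
      where
      powers-raise : ∀ (n : ℕ) → HeightRaising n (x ^ n)
      powers-raise zero    = HeightRaising-1#
      powers-raise (suc n) = subst (λ j → HeightRaising j (x ^ suc n)) (ℕₚ.+-comm n 1)
        (HeightRaising-* {α = x ^ n} {β = x} (powers-raise n) (diagonalPart≈0⇒HeightRaising skeletal πx≈0))

    open UnitsAndIdempotents (End G) using (module IdempotentLifting)
    open IdempotentLifting diagonalPart diagonalPart-cong diagonalPart-+ (diagonalPart-* skeletal) diagonalPart-neg
                           diagonalPart-1# diagonalPart-idempotent (suc nOb) diagonalPart-kernel-nilpotent

    idempotentsSplit : Category.IdempotentsSplit Simp G
    idempotentsSplit ε ε*ε≈ε = Category.splitting-conjugate Simp w*u≈1 u*w≈1 u*πe≈e*u
      (diagonal-splitting (λ X → ε (idm X)) εₓ-idempotent)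
      where
      open Conjugator (lift ε*ε≈ε)
      εₓ-idempotent : ∀ X → (ε (idm X) ∘L ε (idm X)) ≈L ε (idm X)
      εₓ-idempotent X = ≈L-trans (≈L-sym (∘S-at-identity skeletal ε ε X)) (ε*ε≈ε (idm X))

module Representatives (C : FinCat) where

  open FinCat C
  open Heights C using (inhabited?)

  _≃_ : Ob → Ob → Set
  X ≃ Y = Hom X Y × Hom Y X

  _≃?_ : ∀ X Y → Dec (X ≃ Y)
  X ≃? Y = inhabited? (nHom X Y) ×-dec inhabited? (nHom Y X)

  ≃-trans : ∀ {X Y Z} → X ≃ Y → Y ≃ Z → X ≃ Z
  ≃-trans (f , f′) (g , g′) = comp g f , comp f′ g′

  Representative : Ob → Set
  Representative Z = ¬ ∃ λ Z′ → Z′ Fin.< Z × Z′ ≃ Z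

  representative? : ∀ Z → Dec (Representative Z)
  representative? Z = ¬? (any? λ Z′ → (Z′ Fin.<? Z) ×-dec (Z′ ≃? Z))

  representative : ∀ Q → ∃ λ Z → Representative Z × Z ≃ Q
  representative Q = descend Q (<-wellFounded Q)
    where
    descend : ∀ Q → Acc Fin._<_ Q → ∃ λ Z → Representative Z × Z ≃ Q
    descend Q (acc smaller) with any? (λ Z′ → (Z′ Fin.<? Q) ×-dec (Z′ ≃? Q))
    ... | no  least                 = Q , least , (idm Q , idm Q)
    ... | yes (Q′ , Q′<Q , Q′≃Q) with descend Q′ (smaller Q′<Q)
    ...   | Z , Z-rep , Z≃Q′ = Z , Z-rep , ≃-trans Z≃Q′ Q′≃Q

  representative-unique : ∀ {X Y} → Representative X → Representative Y → X ≃ Y → X ≡ Y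
  representative-unique {X} {Y} X-rep Y-rep (f , g) with Finₚ.<-cmp X Y
  ... | tri< X<Y _ _ = ⊥-elim (Y-rep (X , X<Y , (f , g)))
  ... | tri≈ _ X≡Y _ = X≡Y
  ... | tri> _ _ Y<X = ⊥-elim (X-rep (Y , Y<X , (g , f)))

-- The embedding η : P → ν G is mono because in a semitopological category
-- any pair of morphisms Z ⇄ Q is mutually inverse, so P(Q) ≅ P(Z) for the
-- representative Z of Q.
module EssentialSurjectivity (C : FinCat) (semitopological : Semitopological C) where

  open FinCat C
  open Representatives C
  open NuBasis C
  open NuFunctor C
  open Coinduction C
  open PresheafCategory C
  open SimpCategory C
  open SimpIdempotents C semitopological using (SkeletalSupport; idempotentsSplit)

  module _ (P : RawPresheaf C) (isP : IsPresheaf C P) where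

    restrictAt : ∀ Z → Dec (Representative Z) → ℕ
    restrictAt Z (yes _) = dim P Z
    restrictAt Z (no _)  = 0

    G : SimpOb C
    G Z = restrictAt Z (representative? Z)

    G-skeletal : SkeletalSupport G
    G-skeletal {X} {Y} f g X≢Y = from (representative? X) (representative? Y)
      where
      from : (dX : Dec (Representative X)) (dY : Dec (Representative Y)) → restrictAt X dX ≡ 0 ⊎ restrictAt Y dY ≡ 0
      from (yes X-rep) (yes Y-rep) = ⊥-elim (X≢Y (representative-unique X-rep Y-rep (f , g)))
      from (no _)      _           = inj₁ refl
      from (yes _)     (no _)      = inj₂ refl

    inclusionAt : ∀ Z (d : Dec (Representative Z)) → Lin (dim P Z) (restrictAt Z d)
    inclusionAt Z (yes _) = idL (dim P Z)
    inclusionAt Z (no _)  = λ ()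

    inclusion : ∀ Z → Lin (dim P Z) (G Z)
    inclusion Z = inclusionAt Z (representative? Z)

    inclusion-leftCancellative : ∀ {Z} → Representative Z → LeftCancellative (inclusion Z)
    inclusion-leftCancellative {Z} Z-rep N N′ I∘N≈I∘N′ with representative? Z
    ... | yes _     = ≈L-trans (≈L-sym (∘L-identityˡ N)) (≈L-trans I∘N≈I∘N′ (∘L-identityˡ N′))
    ... | no ¬Z-rep = ⊥-elim (¬Z-rep Z-rep)

    η : Components C P (νOb C G)
    η = coinduce G P inclusion

    η-natural : IsNatural C P (νOb C G) η
    η-natural = coinduce-natural G isP inclusion

    η-rows : ∀ {Z Q} (a : Hom Z Q) {k} (M : Lin k (dim P Q)) j c →
             (η Q ∘L M) (νencode G Q (Z , a , j)) c ≡ (inclusion Z ∘L (act P a ∘L M)) j c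
    η-rows {Z} {Q} a M j c = begin
      Σℚ (dim P Q) (λ l → η Q (νencode G Q (Z , a , j)) l * M l c)
        ≡⟨ FiniteSum.Σℚ-cong (dim P Q) (λ l → cong (_* M l c) (coinduce-νencode G P inclusion (Z , a , j) l)) ⟩
      ((inclusion Z ∘L act P a) ∘L M) j c
        ≡⟨ ∘L-assoc (inclusion Z) (act P a) M j c ⟩
      (inclusion Z ∘L (act P a ∘L M)) j c ∎
      where open ≡-Reasoning

    η-leftCancellative : ∀ Q → LeftCancellative (η Q)
    η-leftCancellative Q = through (representative Q)
      where
      through : (∃ λ Z → Representative Z × Z ≃ Q) → LeftCancellative (η Q)
      through (Z , Z-rep , (a , b)) {k} N N′ η∘N≈η∘N′ = begin
        N                               ≈⟨ ∘L-identityˡ N ⟨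
        idL (dim P Q) ∘L N              ≈⟨ ∘L-congʳ {A = N} b∘a≈id ⟨
        (act P b ∘L act P a) ∘L N       ≈⟨ ∘L-assoc (act P b) (act P a) N ⟩
        act P b ∘L (act P a ∘L N)       ≈⟨ ∘L-congˡ {B = act P b} a∘N≈a∘N′ ⟩
        act P b ∘L (act P a ∘L N′)      ≈⟨ ∘L-assoc (act P b) (act P a) N′ ⟨
        (act P b ∘L act P a) ∘L N′      ≈⟨ ∘L-congʳ {A = N′} b∘a≈id ⟩
        idL (dim P Q) ∘L N′             ≈⟨ ∘L-identityˡ N′ ⟩
        N′                              ∎
        where
        open import Relation.Binary.Reasoning.Setoid (Lin-setoid k (dim P Q))
        b∘a≈id : (act P b ∘L act P a) ≈L idL (dim P Q)
        b∘a≈id = ≈L-trans (≈L-sym (IsPresheaf.act-comp isP a b))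
                 (≈L-trans (λ k i → cong (λ ψ → act P ψ k i) (semitopological Q (comp a b))) (IsPresheaf.act-id isP Q))
        a∘N≈a∘N′ : (act P a ∘L N) ≈L (act P a ∘L N′)
        a∘N≈a∘N′ = inclusion-leftCancellative Z-rep (act P a ∘L N) (act P a ∘L N′) λ j c →
          trans (sym (η-rows a N j c)) (trans (η∘N≈η∘N′ _ c) (η-rows a N′ j c))

    η-mono : Mono C (P , isP) (νOb C G , νOb-isPresheaf G) (η , η-natural)
    η-mono R g h _ _ η∘g≈η∘h Q = η-leftCancellative Q (g Q) (h Q) (η∘g≈η∘h Q)

  ν-faithful : Functor.Faithful ν
  ν-faithful {F} {G} = νMor-faithful F G

  ν-full : Functor.Full ν
  ν-full {F} {G} (η , natural) = νMor-full F G η natural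

  injective⇒image-of-ν : ∀ P → Injective C P → ∃ λ F → Category._≅_ PSh (proj₁ P) (νOb C F)
  injective⇒image-of-ν (P , isP) injective =
    let r , r-natural , r∘η≈id = injective (P , isP) (νOb C (G P isP) , νOb-isPresheaf (G P isP)) (η P isP , η-natural P isP)
                                           (η-mono P isP) (idC C P) (proj₂ (Category.id PSh {P}))
    in retract-of-image ν ν-faithful ν-full (idempotentsSplit (G-skeletal P isP)) (η P isP , η-natural P isP) (r , r-natural) r∘η≈id

mainTheorem8 : (C : FinCat) → Semitopological C →
    -- ν(F) is a presheaf, and it is an injective object of Q(C)
    ((F : SimpOb C) → Σ (IsPresheaf C (νOb C F)) (λ p → Injective C (νOb C F , p)))
    -- ν is a functor
    × (∀ F G (α : SimpHom C F G) → IsNatural C (νOb C F) (νOb C G) (νMor C α))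
    × (∀ F → _≈C_ C {νOb C F} {νOb C F} (νMor C (idS C F)) (idC C (νOb C F)))
    × (∀ F G H (β : SimpHom C G H) (α : SimpHom C F G)
         → _≈C_ C {νOb C F} {νOb C H} (νMor C (_∘S_ C {F} {G} {H} β α))
             (_∘C_ C {νOb C F} {νOb C G} {νOb C H} (νMor C β) (νMor C α)))
    -- ν is faithful
    × (∀ F G (α β : SimpHom C F G)
         → _≈C_ C {νOb C F} {νOb C G} (νMor C α) (νMor C β) → _≈S_ C {F} {G} α β)
    -- ν is full
    × (∀ F G (η : Components C (νOb C F) (νOb C G))
         → IsNatural C (νOb C F) (νOb C G) η
         → Σ (SimpHom C F G) (λ α → _≈C_ C {νOb C F} {νOb C G} (νMor C α) η))
    -- ν is essentially surjective onto the injective objects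
    × (∀ (P : Presheaf C) → Injective C P
         → Σ (SimpOb C) (λ F →
           Σ (Components C (νOb C F) (proj₁ P)) (λ u →
           Σ (Components C (proj₁ P) (νOb C F)) (λ v →
             IsNatural C (νOb C F) (proj₁ P) u
             × IsNatural C (proj₁ P) (νOb C F) v
             × _≈C_ C {νOb C F} {νOb C F} (_∘C_ C {νOb C F} {proj₁ P} {νOb C F} v u) (idC C (νOb C F))
             × _≈C_ C {proj₁ P} {proj₁ P} (_∘C_ C {proj₁ P} {νOb C F} {proj₁ P} u v) (idC C (proj₁ P))))))
mainTheorem8 C semitopological =
    (λ F → νOb-isPresheaf F , νOb-injective F)
  , νMor-natural , νMor-id , νMor-∘ , νMor-faithful , νMor-full
  , λ P injective →
      let (F , P≅νF) = injective⇒image-of-ν P injective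
          open Category._≅_ P≅νF
      in F , proj₁ to , proj₁ from , proj₂ to , proj₂ from , isoʳ , isoˡ
  where
  open NuFunctor C
  open Coinduction C
  open EssentialSurjectivity C semitopological
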